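{- The linear map $\varphi_2:\mathrm{HSym}\to\mathrm{SSym}$ is an algebra homomorphism, i.e. $\varphi_2(\sigma\overline{\star}_{ -1}\tau)=\varphi_2(\sigma)\,\overline{\sqcup\!\sqcup}\,\varphi_2(\tau)$ for all signed permutations $\sigma,\tau$ (and $\varphi_2(\imath)=\imath$).
   Context: $\mathfrak{B}_n$ is the set of permutations $\pi$ of $\{ -n,\dots,n\}$ with $\pi(-i)=-\pi(i)$, written as words $\pi_1\cdots\pi_n$, $\mathfrak{B}_0=\{\imath\}$; $\mathfrak{S}_n\subseteq\mathfrak{B}_n$ those with all entries positive. $\mathrm{HSym}=\bigoplus_n\mathbf{k}\mathfrak{B}_n$, $\mathrm{SSym}=\bigoplus_n\mathbf{k}\mathfrak{S}_n$. $\mathrm{st}$ of a word $a_1\cdots a_n$ over $\mathbb{Z}\setminus\{0\}$ is the unique $b_1\cdots b_n\in\mathfrak{B}_n$ with $\mathrm{sign}(b_i)=\mathrm{sign}(a_i)$ and $|b_i|<|b_j|$ whenever $|a_i|<|a_j|$ or ($|a_i|=|a_j|$, $i<j$), extended linearly. On words over $\mathbb{Z}\setminus\{0\}$, $\star_{ -1}$ is the bilinear product with the empty word as identity and $au\star_{ -1}bv=a(u\star_{ -1}bv)+b(au\star_{ -1}v)-(a\bullet b)(u\star_{ -1}v)$, where $a\bullet b=a$ if $a,b<0$ and $0$ otherwise. The product on $\mathrm{HSym}$ is $\sigma\overline{\star}_{ -1}\tau=\mathrm{st}(\sigma\star_{ -1}\tau[m])$ for $\sigma\in\mathfrak{B}_m$,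 where $\tau[m]$ replaces positive letters $i$ by $i+m$ and negative letters $-i$ by $-(i+m)$. The product on $\mathrm{SSym}$ is the shifted shuffle $\sigma\overline{\sqcup\!\sqcup}\tau=\sigma\sqcup\!\sqcup\,\tau[m]$ for $\sigma\in\mathfrak{S}_m$. $\varphi_2$ is defined on $\pi\in\mathfrak{B}_n$ by $\varphi_2(\pi)=(-1)^j\mathrm{st}(\bar\pi)$ if there are $i\ge0$, $j\in\{0,1\}$ with $i+j<n$ such that $\pi_k<0$ for $k\le i$ and for $k>n-j$, and $\pi_k>0$ for $i<k\le n-j$ ($\bar\pi$ the subword of positive entries), and $\varphi_2(\pi)=\delta_{\pi,\imath}$ otherwise. -}

module Defs where

open import Data.Nat as ℕ using (ℕ; zero; suc)
open import Data.Integer as ℤ using (ℤ; +_; -[1+_]; ∣_∣; 0ℤ; 1ℤ; -1ℤ)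
open import Data.Bool using (Bool; true; false; _∧_; _∨_; if_then_else_)
open import Data.List using (List; []; _∷_; length; map; filter; upTo; zip; foldr; concatMap; _++_)
open import Data.List.Properties using (≡-dec)
open import Data.List.Relation.Binary.Permutation.Propositional using (_↭_)
open import Data.Product using (_×_; _,_; proj₁; proj₂)
open import Relation.Binary.PropositionalEquality using (_≡_)
open import Relation.Nullary.Decidable using (⌊_⌋; does)

-- Words over ℤ∖{0} are represented as lists of integers.
Word : Set
Word = List ℤ

-- 𝔅_n : w is a signed permutation of size n, i.e. |w_1| … |w_n| is a
-- permutation of 1 … n.  (𝔖_n are those with all entries positive.)
IsSignedPerm : ℕ → Word → Set
IsSignedPerm n w = map ∣_∣ w ↭ map suc (upTo n)

LinComb : Set
LinComb = List (ℤ × Word)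

coeff : Word → LinComb → ℤ
coeff w [] = 0ℤ
coeff w ((c , v) ∷ L) = (if does (≡-dec ℤ._≟_ v w) then c else 0ℤ) ℤ.+ coeff w L

_≈_ : LinComb → LinComb → Set
L ≈ M = ∀ w → coeff w L ≡ coeff w M
infix 4 _≈_

scale : ℤ → LinComb → LinComb
scale c = map (λ p → c ℤ.* proj₁ p , proj₂ p)

prefix : ℤ → LinComb → LinComb
prefix a = map (λ p → proj₁ p , a ∷ proj₂ p)

linExt : (Word → LinComb) → LinComb → LinComb
linExt f = concatMap (λ p → scale (proj₁ p) (f (proj₂ p)))

bilinExt : (Word → Word → LinComb) → LinComb → LinComb → LinComb
bilinExt f L M =
  concatMap (λ p → concatMap (λ q → scale (proj₁ p ℤ.* proj₁ q) (f (proj₂ p) (proj₂ q))) M) L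

isNeg : ℤ → Bool
isNeg a = ⌊ a ℤ.<? 0ℤ ⌋

isPos : ℤ → Bool
isPos a = ⌊ 0ℤ ℤ.<? a ⌋

-- the product ⋆_{-1} on words:
-- au ⋆ bv = a(u ⋆ bv) + b(au ⋆ v) - (a•b)(u ⋆ v),  a•b = a if a,b<0, else 0
star : Word → Word → LinComb
star [] v = (1ℤ , v) ∷ []
star (a ∷ u) [] = (1ℤ , a ∷ u) ∷ []
star (a ∷ u) (b ∷ v) =
  prefix a (star u (b ∷ v)) ++ prefix b (star (a ∷ u) v)
  ++ (if isNeg a ∧ isNeg b then scale -1ℤ (prefix a (star u v)) else [])

shuffle : Word → Word → LinComb
shuffle [] v = (1ℤ , v) ∷ []
shuffle (a ∷ u) [] = (1ℤ , a ∷ u) ∷ []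
shuffle (a ∷ u) (b ∷ v) = prefix a (shuffle u (b ∷ v)) ++ prefix b (shuffle (a ∷ u) v)

shiftLetter : ℕ → ℤ → ℤ
shiftLetter m a = if isNeg a then ℤ.- (+ (∣ a ∣ ℕ.+ m)) else + (∣ a ∣ ℕ.+ m)

shift : ℕ → Word → Word
shift m = map (shiftLetter m)

-- standardization: st(a)_i has the sign of a_i and absolute value
-- 1 + #{ j : |a_j| < |a_i|  or  (|a_j| = |a_i| and j < i) }
-- (this is the unique b ∈ 𝔅_n described in the paper).
count : {A : Set} → (A → Bool) → List A → ℕ
count p [] = 0
count p (x ∷ xs) = (if p x then 1 else 0) ℕ.+ count p xs

st : Word → Word
st a = map entry ia
  where
  ia : List (ℕ × ℤ)
  ia = zip (upTo (length a)) a
  before : ℕ × ℤ → ℕ × ℤ → Bool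
  before (j , aj) (i , ai) =
    ⌊ ∣ aj ∣ ℕ.<? ∣ ai ∣ ⌋ ∨ (⌊ ∣ aj ∣ ℕ.≟ ∣ ai ∣ ⌋ ∧ ⌊ j ℕ.<? i ⌋)
  entry : ℕ × ℤ → ℤ
  entry (i , ai) =
    let r = suc (count (λ q → before q (i , ai)) ia)
    in if isNeg ai then ℤ.- (+ r) else + r

stL : LinComb → LinComb
stL = map (λ p → proj₁ p , st (proj₂ p))

-- product on HSym (basis elements): σ ⋆̄ τ = st(σ ⋆_{-1} τ[m]), σ ∈ 𝔅_m
hprod : Word → Word → LinComb
hprod σ τ = stL (star σ (shift (length σ) τ))

-- product on SSym (basis elements): σ ⧢̄ τ = σ ⧢ τ[m], σ ∈ 𝔖_m
sprod : Word → Word → LinComb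
sprod σ τ = shuffle σ (shift (length σ) τ)

-- φ₂.  Pattern π i j : with n = length π, i + j < n, π_k < 0 for k ≤ i and
-- for k > n - j, π_k > 0 for i < k ≤ n - j (positions 1-based).
lookupD : Word → ℕ → ℤ
lookupD [] k = 0ℤ
lookupD (x ∷ xs) zero = x
lookupD (x ∷ xs) (suc k) = lookupD xs k

all? : (ℕ → Bool) → ℕ → Bool
all? p zero = true
all? p (suc n) = p n ∧ all? p n

pattern? : Word → ℕ → ℕ → Bool
pattern? π i j =
  ⌊ (i ℕ.+ j) ℕ.<? n ⌋ ∧ all? cond n
  where
  n = length π
  -- position k (1-based) = k0 + 1
  cond : ℕ → Bool
  cond k0 =
    let k = suc k0 ; x = lookupD π k0 in
    if ⌊ k ℕ.≤? i ⌋ ∨ ⌊ (n ℕ.∸ j) ℕ.<? k ⌋ then isNeg x else isPos x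

findPattern : Word → List (ℕ × ℕ)
findPattern π =
  filter (λ p → pattern? π (proj₁ p) (proj₂ p) Data.Bool.≟ true)
    (concatMap (λ i → (i , 0) ∷ (i , 1) ∷ []) (upTo (length π)))
  where import Data.Bool

positives : Word → Word
positives = filter (λ x → 0ℤ ℤ.<? x)

φ₂ : Word → LinComb
φ₂ π with findPattern π
... | (i , j) ∷ _ = ((if ⌊ j ℕ.≟ 0 ⌋ then 1ℤ else -1ℤ) , st (positives π)) ∷ []
... | [] with π
...   | [] = (1ℤ , []) ∷ []
...   | _ ∷ _ = []

φ₂L : LinComb → LinComb
φ₂L = linExt φ₂

-- Write φ₂ π = weight π · st (π⁺), where π⁺ is the subword of positive letters and the
-- integer weight is read off π letter by letter: it is ±1 exactly on the words
-- (negatives)(positives, at least one)(at most one negative) and 0 otherwise.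
-- The heart of the argument is that Ψ : w ↦ weight w · w⁺ turns ⋆₋₁ into the shuffle,
-- Ψ (u ⋆₋₁ v) = Ψ u ⧢ Ψ v, for all words u and v. This goes by induction on u and v,
-- splitting on the signs of the first letters, simultaneously for the weight that admits
-- a leading run of negative letters (κ = 1) and the one that does not (κ = 0); the merge
-- term of ⋆₋₁ is precisely what requires κ * κ = κ.  Standardization commutes with the
-- rest because the letters of σ and τ[m] have pairwise distinct absolute values: on such
-- words st is the rank map, which preserves signs and the order of absolute values.
module Submission where

open import Defs
open import Data.Bool using (Bool; true; false; _∧_; _∨_; if_then_else_)
import Data.Bool.Properties as BoolP
open import Data.Empty using (⊥-elim)
open import Data.Integer as ℤ
  using (ℤ; +_; -[1+_]; +[1+_]; ∣_∣; 0ℤ; 1ℤ; -1ℤ; _+_; _*_; -_; _-_)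
import Data.Integer.Properties as ℤP
open import Data.Integer.Tactic.RingSolver using (solve-∀)
open import Data.List using (List; []; _∷_; length; map; _++_; concat; concatMap; upTo; zip)
import Data.List.Properties as ListP
open import Data.List.Properties using (≡-dec; ∷-injectiveˡ; ∷-injectiveʳ)
open import Data.List.Membership.Propositional using (_∈_)
open import Data.List.Membership.Propositional.Properties
  using (∈-concatMap⁺; ∈-concatMap⁻; ∈-upTo⁺; ∈-upTo⁻; ∈-filter⁺; ∈-filter⁻; ∈-map⁺; ∈-map⁻)
open import Data.List.Relation.Binary.Permutation.Propositional as ↭ using (_↭_)
import Data.List.Relation.Binary.Permutation.Propositional.Properties as PermP
open import Data.List.Relation.Binary.Subset.Propositional using (_⊆_)
import Data.List.Relation.Binary.Subset.Propositional.Properties as SubsetP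
open import Data.List.Relation.Unary.All as All using (All; []; _∷_)
import Data.List.Relation.Unary.All.Properties as AllP
open import Data.List.Relation.Unary.AllPairs using ([]; _∷_)
import Data.List.Relation.Unary.AllPairs.Properties as AllPairsP
import Data.List.Relation.Unary.Any as Any
open import Data.List.Relation.Unary.Any using (here; there; satisfied)
open import Data.List.Relation.Unary.Unique.Propositional using (Unique)
import Data.List.Relation.Unary.Unique.Propositional.Properties as UniqueP
open import Data.Nat as ℕ using (ℕ; zero; suc; _∸_)
import Data.Nat.Properties as NatP
open import Data.Product as Product using (_×_; _,_; proj₁; proj₂; ∃-syntax)
open import Function using (_∘_; case_of_)
open import Function.Bundles using (mk⇔)
open import Level using (0ℓ)
open import Relation.Binary.Bundles using (Setoid)
open import Relation.Binary.Definitions using (tri<; tri≈; tri>)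
open import Relation.Binary.PropositionalEquality
import Relation.Binary.Reasoning.Setoid
import Data.List.Relation.Binary.Permutation.Setoid.Properties (setoid ℕ) as PermSetoidP
open import Relation.Nullary using (¬_; Dec; does; yes; no)
open import Relation.Nullary.Decidable using (⌊_⌋; does-⇔; dec-true; dec-false; isYes≗does)

-- Linear combinations

infix 4 _≃_

-- A record around _≈_: unfolded, _≈_ is a Π-type from which Agda cannot recover
-- the two linear combinations, so lemmas about _≈_ would need them explicitly.
record _≃_ (L M : LinComb) : Set where
  constructor coeffwise
  field coeff-≡ : L ≈ M
open _≃_ public

≃-refl : ∀ {L} → L ≃ L
≃-refl = coeffwise λ _ → refl

≃-sym : ∀ {L M} → L ≃ M → M ≃ L
≃-sym (coeffwise p) = coeffwise λ w → sym (p w)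

≃-trans : ∀ {L M N} → L ≃ M → M ≃ N → L ≃ N
≃-trans (coeffwise p) (coeffwise q) = coeffwise λ w → trans (p w) (q w)

≡⇒≃ : ∀ {L M} → L ≡ M → L ≃ M
≡⇒≃ refl = ≃-refl

≃-setoid : Setoid 0ℓ 0ℓ
≃-setoid = record
  { Carrier       = LinComb
  ; _≈_           = _≃_
  ; isEquivalence = record { refl = ≃-refl ; sym = ≃-sym ; trans = ≃-trans }
  }

module ≃-Reasoning = Relation.Binary.Reasoning.Setoid ≃-setoid

word? : Word → Word → Bool
word? v w = does (≡-dec ℤ._≟_ v w)

word?-refl : ∀ v → word? v v ≡ true
word?-refl v = dec-true (≡-dec ℤ._≟_ v v) refl

word?-≢ : ∀ {v w} → v ≢ w → word? v w ≡ false
word?-≢ {v} {w} = dec-false (≡-dec ℤ._≟_ v w)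

coeff-++ : ∀ w L M → coeff w (L ++ M) ≡ coeff w L + coeff w M
coeff-++ w [] M = sym (ℤP.+-identityˡ _)
coeff-++ w ((c , v) ∷ L) M rewrite coeff-++ w L M =
  sym (ℤP.+-assoc (if word? v w then c else 0ℤ) (coeff w L) (coeff w M))

coeff-scale : ∀ w c L → coeff w (scale c L) ≡ c * coeff w L
coeff-scale w c [] = sym (ℤP.*-zeroʳ c)
coeff-scale w c ((d , v) ∷ L) rewrite coeff-scale w c L with word? v w
... | true = sym (ℤP.*-distribˡ-+ c d (coeff w L))
... | false = trans (cong (λ r → r + c * coeff w L) (sym (ℤP.*-zeroʳ c))) (sym (ℤP.*-distribˡ-+ c 0ℤ (coeff w L)))

coeff-singleton : ∀ w k v → coeff w ((k , v) ∷ []) ≡ (if word? v w then k else 0ℤ)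
coeff-singleton w k v = ℤP.+-identityʳ _

coeff-prefix-∷ : ∀ a w L → coeff (a ∷ w) (prefix a L) ≡ coeff w L
coeff-prefix-∷ a w [] = refl
coeff-prefix-∷ a w ((c , v) ∷ L) = cong₂ (λ b r → (if b then c else 0ℤ) + r)
  (does-⇔ (mk⇔ ∷-injectiveʳ (cong (a ∷_))) (≡-dec ℤ._≟_ (a ∷ v) (a ∷ w)) (≡-dec ℤ._≟_ v w))
  (coeff-prefix-∷ a w L)

coeff-prefix-other : ∀ a w L → (∀ w′ → w ≢ a ∷ w′) → coeff w (prefix a L) ≡ 0ℤ
coeff-prefix-other a w [] w≢ = refl
coeff-prefix-other a w ((c , v) ∷ L) w≢ rewrite word?-≢ (λ eq → w≢ v (sym eq)) =
  trans (ℤP.+-identityˡ _) (coeff-prefix-other a w L w≢)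

++-cong : ∀ {L L′ M M′} → L ≃ L′ → M ≃ M′ → L ++ M ≃ L′ ++ M′
++-cong {L} {L′} {M} {M′} (coeffwise p) (coeffwise q) = coeffwise λ w → begin
    coeff w (L ++ M)           ≡⟨ coeff-++ w L M ⟩
    coeff w L + coeff w M      ≡⟨ cong₂ _+_ (p w) (q w) ⟩
    coeff w L′ + coeff w M′    ≡⟨ coeff-++ w L′ M′ ⟨
    coeff w (L′ ++ M′)         ∎
  where open ≡-Reasoning

scale-cong : ∀ c {L M} → L ≃ M → scale c L ≃ scale c M
scale-cong c {L} {M} (coeffwise p) = coeffwise λ w →
  trans (coeff-scale w c L) (trans (cong (c *_) (p w)) (sym (coeff-scale w c M)))

prefix-cong : ∀ a {L M} → L ≃ M → prefix a L ≃ prefix a M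
prefix-cong a {L} {M} (coeffwise p) = coeffwise coeff≡
  where
  coeff≡ : prefix a L ≈ prefix a M
  coeff≡ [] = trans (coeff-prefix-other a [] L λ _ ()) (sym (coeff-prefix-other a [] M λ _ ()))
  coeff≡ (x ∷ w) with x ℤ.≟ a
  ... | yes refl = trans (coeff-prefix-∷ a w L) (trans (p w) (sym (coeff-prefix-∷ a w M)))
  ... | no x≢a = trans (coeff-prefix-other a (x ∷ w) L x∷w≢) (sym (coeff-prefix-other a (x ∷ w) M x∷w≢))
    where
    x∷w≢ : ∀ w′ → x ∷ w ≢ a ∷ w′
    x∷w≢ w′ = x≢a ∘ ∷-injectiveˡ

scale-++ : ∀ c L M → scale c (L ++ M) ≡ scale c L ++ scale c M
scale-++ c = ListP.map-++ _

prefix-scale : ∀ a c L → prefix a (scale c L) ≡ scale c (prefix a L)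
prefix-scale a c L = trans (sym (ListP.map-∘ L)) (ListP.map-∘ L)

scale-scale : ∀ c d L → scale c (scale d L) ≡ scale (c * d) L
scale-scale c d L = trans (sym (ListP.map-∘ L))
  (ListP.map-cong (λ { (e , w) → cong (_, w) (sym (ℤP.*-assoc c d e)) }) L)

scale-zero : ∀ L → scale 0ℤ L ≃ []
scale-zero L = coeffwise λ w → coeff-scale w 0ℤ L

scale-null : ∀ {c} L → c ≡ 0ℤ → scale c L ≃ []
scale-null L refl = scale-zero L

scale-distrib : ∀ c d L → scale c L ++ scale d L ≃ scale (c + d) L
scale-distrib c d L = coeffwise λ w → begin
    coeff w (scale c L ++ scale d L)             ≡⟨ coeff-++ w (scale c L) (scale d L) ⟩
    coeff w (scale c L) + coeff w (scale d L)    ≡⟨ cong₂ _+_ (coeff-scale w c L) (coeff-scale w d L) ⟩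
    c * coeff w L + d * coeff w L                ≡⟨ ℤP.*-distribʳ-+ (coeff w L) c d ⟨
    (c + d) * coeff w L                          ≡⟨ coeff-scale w (c + d) L ⟨
    coeff w (scale (c + d) L)                    ∎
  where open ≡-Reasoning

scale-collect₃ : ∀ {A B C} c₁ c₂ c₃ P → A ≃ scale c₁ P → B ≃ scale c₂ P → C ≃ scale c₃ P →
  A ++ B ++ C ≃ scale (c₁ + (c₂ + c₃)) P
scale-collect₃ {A} {B} {C} c₁ c₂ c₃ P A≃ B≃ C≃ = begin
    A ++ B ++ C                               ≈⟨ ++-cong A≃ (++-cong B≃ C≃) ⟩
    scale c₁ P ++ scale c₂ P ++ scale c₃ P    ≈⟨ ++-cong (≃-refl {scale c₁ P}) (scale-distrib c₂ c₃ P) ⟩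
    scale c₁ P ++ scale (c₂ + c₃) P           ≈⟨ scale-distrib c₁ (c₂ + c₃) P ⟩
    scale (c₁ + (c₂ + c₃)) P                  ∎
  where open ≃-Reasoning

singleton-split : ∀ k₁ k₂ v → (k₁ + k₂ , v) ∷ [] ≃ (k₁ , v) ∷ (k₂ , v) ∷ []
singleton-split k₁ k₂ v = coeffwise λ w → begin
    coeff w ((k₁ + k₂ , v) ∷ [])                   ≡⟨ coeff-singleton w (k₁ + k₂) v ⟩
    (if word? v w then k₁ + k₂ else 0ℤ)           ≡⟨ split (word? v w) ⟩
    (if word? v w then k₁ else 0ℤ) + (if word? v w then k₂ else 0ℤ)
                                                   ≡⟨ cong (λ r → (if word? v w then k₁ else 0ℤ) + r) (coeff-singleton w k₂ v) ⟨
    coeff w ((k₁ , v) ∷ (k₂ , v) ∷ [])             ∎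
  where
  open ≡-Reasoning
  split : ∀ b → (if b then k₁ + k₂ else 0ℤ) ≡ (if b then k₁ else 0ℤ) + (if b then k₂ else 0ℤ)
  split true = refl
  split false = refl

singleton-null : ∀ {k} v → k ≡ 0ℤ → (k , v) ∷ [] ≃ []
singleton-null v refl = coeffwise λ w → trans (coeff-singleton w 0ℤ v) (if-same (word? v w))
  where
  if-same : ∀ b → (if b then 0ℤ else 0ℤ) ≡ 0ℤ
  if-same true = refl
  if-same false = refl

-- Linear extensions

pairing : LinComb → (Word → ℤ) → ℤ
pairing [] h = 0ℤ
pairing ((c , v) ∷ L) h = c * h v + pairing L h

coeff-linExt : ∀ w f L → coeff w (linExt f L) ≡ pairing L (λ v → coeff w (f v))
coeff-linExt w f [] = refl
coeff-linExt w f ((c , v) ∷ L) = begin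
    coeff w (scale c (f v) ++ linExt f L)                 ≡⟨ coeff-++ w (scale c (f v)) (linExt f L) ⟩
    coeff w (scale c (f v)) + coeff w (linExt f L)        ≡⟨ cong₂ _+_ (coeff-scale w c (f v)) (coeff-linExt w f L) ⟩
    c * coeff w (f v) + pairing L (λ v → coeff w (f v))   ∎
  where open ≡-Reasoning

pairing-++ : ∀ L M h → pairing (L ++ M) h ≡ pairing L h + pairing M h
pairing-++ [] M h = sym (ℤP.+-identityˡ _)
pairing-++ ((c , v) ∷ L) M h rewrite pairing-++ L M h = sym (ℤP.+-assoc (c * h v) (pairing L h) (pairing M h))

pairing-scale : ∀ d L h → pairing (scale d L) h ≡ d * pairing L h
pairing-scale d [] h = sym (ℤP.*-zeroʳ d)
pairing-scale d ((c , v) ∷ L) h rewrite pairing-scale d L h = distrib d c (h v) (pairing L h)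
  where
  distrib : ∀ d c x y → d * c * x + d * y ≡ d * (c * x + y)
  distrib = solve-∀

pairing-ext : ∀ L {h g} → (∀ v → h v ≡ g v) → pairing L h ≡ pairing L g
pairing-ext [] h≗g = refl
pairing-ext ((c , v) ∷ L) h≗g = cong₂ (λ x y → c * x + y) (h≗g v) (pairing-ext L h≗g)

pairing-+ : ∀ L h g → pairing L (λ v → h v + g v) ≡ pairing L h + pairing L g
pairing-+ [] h g = refl
pairing-+ ((c , v) ∷ L) h g rewrite pairing-+ L h g = distrib c (h v) (g v) (pairing L h) (pairing L g)
  where
  distrib : ∀ c x y r s → c * (x + y) + (r + s) ≡ c * x + r + (c * y + s)
  distrib = solve-∀

pairing-* : ∀ L d h → pairing L (λ v → d * h v) ≡ d * pairing L h
pairing-* [] d h = sym (ℤP.*-zeroʳ d)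
pairing-* ((c , v) ∷ L) d h rewrite pairing-* L d h = distrib c d (h v) (pairing L h)
  where
  distrib : ∀ c d x y → c * (d * x) + d * y ≡ d * (c * x + y)
  distrib = solve-∀

dropWord : Word → LinComb → LinComb
dropWord v [] = []
dropWord v ((c , u) ∷ L) = if word? u v then dropWord v L else (c , u) ∷ dropWord v L

length-dropWord : ∀ v L → length (dropWord v L) ℕ.≤ length L
length-dropWord v [] = ℕ.z≤n
length-dropWord v ((c , u) ∷ L) with word? u v
... | true = NatP.m≤n⇒m≤1+n (length-dropWord v L)
... | false = ℕ.s≤s (length-dropWord v L)

pairing-dropWord : ∀ v L h → pairing L h ≡ coeff v L * h v + pairing (dropWord v L) h
pairing-dropWord v [] h = refl
pairing-dropWord v ((c , u) ∷ L) h with ≡-dec ℤ._≟_ u v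
... | yes refl rewrite pairing-dropWord u L h = collect c (coeff u L) (h u) (pairing (dropWord u L) h)
  where
  collect : ∀ c k x r → c * x + (k * x + r) ≡ (c + k) * x + r
  collect = solve-∀
... | no _ rewrite pairing-dropWord v L h = skip (c * h u) (coeff v L) (h v) (pairing (dropWord v L) h)
  where
  skip : ∀ y k x r → y + (k * x + r) ≡ (0ℤ + k) * x + (y + r)
  skip = solve-∀

coeff-dropWord-self : ∀ v L → coeff v (dropWord v L) ≡ 0ℤ
coeff-dropWord-self v [] = refl
coeff-dropWord-self v ((c , u) ∷ L) with word? u v in u≟v
... | true = coeff-dropWord-self v L
... | false rewrite u≟v = trans (ℤP.+-identityˡ _) (coeff-dropWord-self v L)

coeff-dropWord-other : ∀ {v w} L → v ≢ w → coeff w (dropWord v L) ≡ coeff w L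
coeff-dropWord-other [] v≢w = refl
coeff-dropWord-other {v} {w} ((c , u) ∷ L) v≢w with ≡-dec ℤ._≟_ u v
... | yes refl = begin
    coeff w (dropWord u L)                        ≡⟨ coeff-dropWord-other L v≢w ⟩
    coeff w L                                     ≡⟨ ℤP.+-identityˡ _ ⟨
    0ℤ + coeff w L                                ≡⟨ cong (λ b → (if b then c else 0ℤ) + coeff w L) (word?-≢ v≢w) ⟨
    (if word? u w then c else 0ℤ) + coeff w L     ∎
  where open ≡-Reasoning
... | no _ = cong (λ r → (if word? u w then c else 0ℤ) + r) (coeff-dropWord-other L v≢w)

dropWord-null : ∀ v L → L ≃ [] → dropWord v L ≃ []
dropWord-null v L (coeffwise L≈[]) = coeffwise coeff≡0
  where
  coeff≡0 : ∀ w → coeff w (dropWord v L) ≡ 0ℤ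
  coeff≡0 w with ≡-dec ℤ._≟_ v w
  ... | yes refl = coeff-dropWord-self v L
  ... | no v≢w = trans (coeff-dropWord-other L v≢w) (L≈[] w)

-- Induction on the length, removing all occurrences of the first word at once.
pairing-null : ∀ n L h → length L ℕ.≤ n → L ≃ [] → pairing L h ≡ 0ℤ
pairing-null n [] h _ _ = refl
pairing-null (suc n) L@((c , v) ∷ L′) h (ℕ.s≤s |L′|≤n) L≃[] = begin
    pairing L h                                    ≡⟨ pairing-dropWord v L h ⟩
    coeff v L * h v + pairing (dropWord v L) h     ≡⟨ cong (λ k → k * h v + pairing (dropWord v L) h) (coeff-≡ L≃[] v) ⟩
    0ℤ + pairing (dropWord v L) h                  ≡⟨ ℤP.+-identityˡ _ ⟩
    pairing (dropWord v L) h                       ≡⟨ pairing-null n (dropWord v L) h |drop|≤n (dropWord-null v L L≃[]) ⟩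
    0ℤ                                             ∎
  where
  open ≡-Reasoning
  |drop|≤n : length (dropWord v L) ℕ.≤ n
  |drop|≤n rewrite word?-refl v = NatP.≤-trans (length-dropWord v L′) |L′|≤n

pairing-cong : ∀ {L M} h → L ≃ M → pairing L h ≡ pairing M h
pairing-cong {L} {M} h L≃M = begin
    pairing L h                                            ≡⟨ expand (pairing L h) (pairing M h) ⟩
    pairing L h + -1ℤ * pairing M h + pairing M h          ≡⟨ cong (λ x → pairing L h + x + pairing M h) (pairing-scale -1ℤ M h) ⟨
    pairing L h + pairing (scale -1ℤ M) h + pairing M h    ≡⟨ cong (λ x → x + pairing M h) (pairing-++ L (scale -1ℤ M) h) ⟨
    pairing (L ++ scale -1ℤ M) h + pairing M h             ≡⟨ cong (λ x → x + pairing M h)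
                                                                 (pairing-null _ (L ++ scale -1ℤ M) h NatP.≤-refl difference-null) ⟩
    0ℤ + pairing M h                                       ≡⟨ ℤP.+-identityˡ _ ⟩
    pairing M h                                            ∎
  where
  open ≡-Reasoning
  expand : ∀ l m → l ≡ l + -1ℤ * m + m
  expand = solve-∀
  cancel : ∀ m → m + -1ℤ * m ≡ 0ℤ
  cancel = solve-∀
  difference-null : L ++ scale -1ℤ M ≃ []
  difference-null = coeffwise λ w → begin
    coeff w (L ++ scale -1ℤ M)             ≡⟨ coeff-++ w L (scale -1ℤ M) ⟩
    coeff w L + coeff w (scale -1ℤ M)      ≡⟨ cong₂ _+_ (coeff-≡ L≃M w) (coeff-scale w -1ℤ M) ⟩
    coeff w M + -1ℤ * coeff w M            ≡⟨ cancel (coeff w M) ⟩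
    0ℤ                                     ∎

linExt-cong : ∀ f {L M} → L ≃ M → linExt f L ≃ linExt f M
linExt-cong f {L} {M} L≃M = coeffwise λ w →
  trans (coeff-linExt w f L) (trans (pairing-cong (λ v → coeff w (f v)) L≃M) (sym (coeff-linExt w f M)))

linExt-cong-local : ∀ {f g} L → All (λ q → f (proj₂ q) ≃ g (proj₂ q)) L → linExt f L ≃ linExt g L
linExt-cong-local [] [] = ≃-refl
linExt-cong-local ((c , w) ∷ L) (fw≃gw ∷ rest) = ++-cong (scale-cong c fw≃gw) (linExt-cong-local L rest)

linExt-pointwise : ∀ {f g} L → (∀ w → f w ≃ g w) → linExt f L ≃ linExt g L
linExt-pointwise L f≃g = linExt-cong-local L (All.tabulate λ {q} _ → f≃g (proj₂ q))

linExt-++ : ∀ f L M → linExt f (L ++ M) ≡ linExt f L ++ linExt f M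
linExt-++ f = ListP.concatMap-++ _

linExt-scale : ∀ f c L → linExt f (scale c L) ≃ scale c (linExt f L)
linExt-scale f c L = coeffwise λ w → begin
    coeff w (linExt f (scale c L))               ≡⟨ coeff-linExt w f (scale c L) ⟩
    pairing (scale c L) (λ v → coeff w (f v))    ≡⟨ pairing-scale c L (λ v → coeff w (f v)) ⟩
    c * pairing L (λ v → coeff w (f v))          ≡⟨ cong (c *_) (coeff-linExt w f L) ⟨
    c * coeff w (linExt f L)                     ≡⟨ coeff-scale w c (linExt f L) ⟨
    coeff w (scale c (linExt f L))               ∎
  where open ≡-Reasoning

linExt-++ᶠ : ∀ f g L → linExt (λ w → f w ++ g w) L ≃ linExt f L ++ linExt g L
linExt-++ᶠ f g L = coeffwise λ w → begin
    coeff w (linExt (λ v → f v ++ g v) L)              ≡⟨ coeff-linExt w (λ v → f v ++ g v) L ⟩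
    pairing L (λ v → coeff w (f v ++ g v))             ≡⟨ pairing-ext L (λ v → coeff-++ w (f v) (g v)) ⟩
    pairing L (λ v → coeff w (f v) + coeff w (g v))    ≡⟨ pairing-+ L (λ v → coeff w (f v)) (λ v → coeff w (g v)) ⟩
    pairing L (λ v → coeff w (f v)) + pairing L (λ v → coeff w (g v))
                                                       ≡⟨ cong₂ _+_ (coeff-linExt w f L) (coeff-linExt w g L) ⟨
    coeff w (linExt f L) + coeff w (linExt g L)        ≡⟨ coeff-++ w (linExt f L) (linExt g L) ⟨
    coeff w (linExt f L ++ linExt g L)                 ∎
  where open ≡-Reasoning

linExt-scaleᶠ : ∀ c f L → linExt (λ w → scale c (f w)) L ≃ scale c (linExt f L)
linExt-scaleᶠ c f L = coeffwise λ w → begin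
    coeff w (linExt (λ v → scale c (f v)) L)     ≡⟨ coeff-linExt w (λ v → scale c (f v)) L ⟩
    pairing L (λ v → coeff w (scale c (f v)))    ≡⟨ pairing-ext L (λ v → coeff-scale w c (f v)) ⟩
    pairing L (λ v → c * coeff w (f v))          ≡⟨ pairing-* L c (λ v → coeff w (f v)) ⟩
    c * pairing L (λ v → coeff w (f v))          ≡⟨ cong (c *_) (coeff-linExt w f L) ⟨
    c * coeff w (linExt f L)                     ≡⟨ coeff-scale w c (linExt f L) ⟨
    coeff w (scale c (linExt f L))               ∎
  where open ≡-Reasoning

concatMap-cong : ∀ {A : Set} {g g′ : A → LinComb} xs → (∀ x → g x ≃ g′ x) → concatMap g xs ≃ concatMap g′ xs
concatMap-cong [] g≃g′ = ≃-refl
concatMap-cong (x ∷ xs) g≃g′ = ++-cong (g≃g′ x) (concatMap-cong xs g≃g′)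

bilinExt-as-linExt : ∀ f L M → bilinExt f L M ≃ linExt (λ x → linExt (f x) M) L
bilinExt-as-linExt f L M = concatMap-cong L λ { (c , x) → begin
    concatMap (λ q → scale (c * proj₁ q) (f x (proj₂ q))) M    ≡⟨ cong concat (ListP.map-∘ M) ⟩
    linExt (f x) (scale c M)                                   ≈⟨ linExt-scale (f x) c M ⟩
    scale c (linExt (f x) M)                                   ∎ }
  where open ≃-Reasoning

bilinExt-cong : ∀ f {L L′ M M′} → L ≃ L′ → M ≃ M′ → bilinExt f L M ≃ bilinExt f L′ M′
bilinExt-cong f {L} {L′} {M} {M′} L≃L′ M≃M′ = begin
    bilinExt f L M                      ≈⟨ bilinExt-as-linExt f L M ⟩
    linExt (λ x → linExt (f x) M) L     ≈⟨ linExt-cong (λ x → linExt (f x) M) L≃L′ ⟩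
    linExt (λ x → linExt (f x) M) L′    ≈⟨ linExt-pointwise L′ (λ x → linExt-cong (f x) M≃M′) ⟩
    linExt (λ x → linExt (f x) M′) L′   ≈⟨ bilinExt-as-linExt f L′ M′ ⟨
    bilinExt f L′ M′                    ∎
  where open ≃-Reasoning

bilinExt-singletons : ∀ f c x d y → bilinExt f ((c , x) ∷ []) ((d , y) ∷ []) ≡ scale (c * d) (f x y)
bilinExt-singletons f c x d y = trans (ListP.++-identityʳ _) (ListP.++-identityʳ _)

-- From ⋆₋₁ to the shuffle

Ψ : (Word → ℤ) → LinComb → LinComb
Ψ h = linExt (λ w → (h w , positives w) ∷ [])

ε : Word → ℤ
ε [] = 1ℤ
ε (_ ∷ _) = 0ℤ

-- weight 1ℤ is the coefficient of φ₂ (see φ₂-weight) and weight 0ℤ its variant for words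
-- that must begin with a positive letter: a negative letter belongs either to the leading
-- negative run (factor κ) or is the last letter (the term - ε w).
weight : ℤ → Word → ℤ
weight κ [] = 1ℤ
weight κ (x ∷ w) = if isPos x then weight 0ℤ w else if isNeg x then κ * weight κ w - ε w else 0ℤ

shuffle⁺ : Word → Word → LinComb
shuffle⁺ u v = shuffle (positives u) (positives v)

StarToShuffle : (Word → ℤ) → Word → Word → Set
StarToShuffle h u v = Ψ h (star u v) ≃ scale (h u * h v) (shuffle⁺ u v)

WeightStarToShuffle : Word → Word → Set
WeightStarToShuffle u v = ∀ {μ} → μ * μ ≡ μ → StarToShuffle (weight μ) u v

merge : ℤ → ℤ → Word → Word → LinComb
merge a b u v = if isNeg a ∧ isNeg b then scale -1ℤ (prefix a (star u v)) else []

shuffle-identityʳ : ∀ u → shuffle u [] ≡ (1ℤ , u) ∷ []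
shuffle-identityʳ [] = refl
shuffle-identityʳ (_ ∷ _) = refl

Ψ-++ : ∀ h L M → Ψ h (L ++ M) ≡ Ψ h L ++ Ψ h M
Ψ-++ h = linExt-++ (λ w → (h w , positives w) ∷ [])

Ψ-scale : ∀ h c L → Ψ h (scale c L) ≃ scale c (Ψ h L)
Ψ-scale h = linExt-scale (λ w → (h w , positives w) ∷ [])

Ψ-star-∷ : ∀ h a b u v → Ψ h (star (a ∷ u) (b ∷ v)) ≡
  Ψ h (prefix a (star u (b ∷ v))) ++ Ψ h (prefix b (star (a ∷ u) v)) ++ Ψ h (merge a b u v)
Ψ-star-∷ h a b u v = trans (Ψ-++ h (prefix a (star u (b ∷ v))) _)
  (cong (Ψ h (prefix a (star u (b ∷ v))) ++_) (Ψ-++ h (prefix b (star (a ∷ u) v)) (merge a b u v)))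

Ψ-prefix⁺ : ∀ h n L → Ψ h (prefix +[1+ n ] L) ≡ prefix +[1+ n ] (Ψ (h ∘ (+[1+ n ] ∷_)) L)
Ψ-prefix⁺ h n [] = refl
Ψ-prefix⁺ h n ((c , v) ∷ L) = cong (_ ∷_) (Ψ-prefix⁺ h n L)

Ψ-prefix⁻ : ∀ h n L → Ψ h (prefix -[1+ n ] L) ≡ Ψ (h ∘ (-[1+ n ] ∷_)) L
Ψ-prefix⁻ h n [] = refl
Ψ-prefix⁻ h n ((c , v) ∷ L) = cong (_ ∷_) (Ψ-prefix⁻ h n L)

Ψ-prefix-null : ∀ h a L → (∀ w → h (a ∷ w) ≡ 0ℤ) → Ψ h (prefix a L) ≃ []
Ψ-prefix-null h a [] h≡0 = ≃-refl
Ψ-prefix-null h a ((c , v) ∷ L) h≡0 =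
  ++-cong {L = (c * h (a ∷ v) , positives (a ∷ v)) ∷ []}
    (singleton-null (positives (a ∷ v)) (trans (cong (c *_) (h≡0 v)) (ℤP.*-zeroʳ c)))
    (Ψ-prefix-null h a L h≡0)

Ψ-merge-null : ∀ h a b u v → (∀ w → h (a ∷ w) ≡ 0ℤ) → Ψ h (merge a b u v) ≃ []
Ψ-merge-null h a b u v h≡0 with isNeg a ∧ isNeg b
... | true = ≃-trans (Ψ-scale h -1ℤ (prefix a (star u v))) (scale-cong -1ℤ (Ψ-prefix-null h a (star u v) h≡0))
... | false = ≃-refl

merge-nonneg : ∀ a b u v → isNeg b ≡ false → merge a b u v ≡ []
merge-nonneg a b u v b≥0 rewrite b≥0 | BoolP.∧-zeroʳ (isNeg a) = refl

Ψ-difference : ∀ c f g L → Ψ (λ w → c * f w - g w) L ≃ scale c (Ψ f L) ++ scale -1ℤ (Ψ g L)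
Ψ-difference c f g L = begin
    Ψ (λ w → c * f w - g w) L                                   ≈⟨ linExt-pointwise L split ⟩
    linExt (λ w → scale c (F w) ++ scale -1ℤ (G w)) L           ≈⟨ linExt-++ᶠ (λ w → scale c (F w)) (λ w → scale -1ℤ (G w)) L ⟩
    linExt (λ w → scale c (F w)) L ++ linExt (λ w → scale -1ℤ (G w)) L
                                                                ≈⟨ ++-cong (linExt-scaleᶠ c F L) (linExt-scaleᶠ -1ℤ G L) ⟩
    scale c (Ψ f L) ++ scale -1ℤ (Ψ g L)                        ∎
  where
  open ≃-Reasoning
  F G : Word → LinComb
  F w = (f w , positives w) ∷ []
  G w = (g w , positives w) ∷ []
  split : ∀ w → (c * f w - g w , positives w) ∷ [] ≃ scale c (F w) ++ scale -1ℤ (G w)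
  split w = ≃-trans (≡⇒≃ (cong (λ k → (c * f w + k , positives w) ∷ []) (sym (ℤP.-1*i≡-i (g w)))))
                    (singleton-split (c * f w) (-1ℤ * g w) (positives w))

star-shuffle-[]ˡ : ∀ h → h [] ≡ 1ℤ → ∀ v → StarToShuffle h [] v
star-shuffle-[]ˡ h h[]≡1 v = ≡⇒≃ (cong (λ k → (k , positives v) ∷ []) coefficient)
  where
  coefficient : 1ℤ * h v ≡ h [] * h v * 1ℤ
  coefficient rewrite h[]≡1 = sym (ℤP.*-identityʳ _)

star-shuffle-[]ʳ : ∀ h → h [] ≡ 1ℤ → ∀ a u → StarToShuffle h (a ∷ u) []
star-shuffle-[]ʳ h h[]≡1 a u rewrite shuffle-identityʳ (positives (a ∷ u)) =
  ≡⇒≃ (cong (λ k → (k , positives (a ∷ u)) ∷ []) coefficient)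
  where
  coefficient : 1ℤ * h (a ∷ u) ≡ h (a ∷ u) * h [] * 1ℤ
  coefficient rewrite h[]≡1 = trans (ℤP.*-comm 1ℤ _) (sym (ℤP.*-identityʳ _))

ε-star-shuffle : ∀ u v → StarToShuffle ε u v
ε-star-shuffle [] v = star-shuffle-[]ˡ ε refl v
ε-star-shuffle (a ∷ u) [] = star-shuffle-[]ʳ ε refl a u
ε-star-shuffle (a ∷ u) (b ∷ v) = begin
    Ψ ε (star (a ∷ u) (b ∷ v))                        ≡⟨ Ψ-star-∷ ε a b u v ⟩
    Ψ ε (prefix a (star u (b ∷ v))) ++ Ψ ε (prefix b (star (a ∷ u) v)) ++ Ψ ε (merge a b u v)
                                                      ≈⟨ ++-cong (Ψ-prefix-null ε a (star u (b ∷ v)) (λ _ → refl))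
                                                           (++-cong (Ψ-prefix-null ε b (star (a ∷ u) v) (λ _ → refl))
                                                                    (Ψ-merge-null ε a b u v (λ _ → refl))) ⟩
    []                                                ≈⟨ scale-zero (shuffle⁺ (a ∷ u) (b ∷ v)) ⟨
    scale 0ℤ (shuffle⁺ (a ∷ u) (b ∷ v))               ∎
  where open ≃-Reasoning

Ψ-weight-prefix⁺ : ∀ κ n u v → StarToShuffle (weight 0ℤ) u v →
  Ψ (weight κ) (prefix +[1+ n ] (star u v)) ≃ scale (weight 0ℤ u * weight 0ℤ v) (prefix +[1+ n ] (shuffle⁺ u v))
Ψ-weight-prefix⁺ κ n u v hom = begin
    Ψ (weight κ) (prefix a (star u v))        ≡⟨ Ψ-prefix⁺ (weight κ) n (star u v) ⟩
    prefix a (Ψ (weight 0ℤ) (star u v))       ≈⟨ prefix-cong a hom ⟩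
    prefix a (scale c (shuffle⁺ u v))         ≡⟨ prefix-scale a c (shuffle⁺ u v) ⟩
    scale c (prefix a (shuffle⁺ u v))         ∎
  where
  open ≃-Reasoning
  a c : ℤ
  a = +[1+ n ]
  c = weight 0ℤ u * weight 0ℤ v

Ψ-weight-prefix⁻ : ∀ κ n u v → StarToShuffle (weight κ) u v →
  Ψ (weight κ) (prefix -[1+ n ] (star u v)) ≃ scale (κ * (weight κ u * weight κ v) + -1ℤ * (ε u * ε v)) (shuffle⁺ u v)
Ψ-weight-prefix⁻ κ n u v hom = begin
    Ψ (weight κ) (prefix -[1+ n ] (star u v))                   ≡⟨ Ψ-prefix⁻ (weight κ) n (star u v) ⟩
    Ψ (λ w → κ * weight κ w - ε w) (star u v)                   ≈⟨ Ψ-difference κ (weight κ) ε (star u v) ⟩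
    scale κ (Ψ (weight κ) (star u v)) ++ scale -1ℤ (Ψ ε (star u v))
                                                                ≈⟨ ++-cong (scale-cong κ hom) (scale-cong -1ℤ (ε-star-shuffle u v)) ⟩
    scale κ (scale c P) ++ scale -1ℤ (scale e P)                ≡⟨ cong₂ _++_ (scale-scale κ c P) (scale-scale -1ℤ e P) ⟩
    scale (κ * c) P ++ scale (-1ℤ * e) P                        ≈⟨ scale-distrib (κ * c) (-1ℤ * e) P ⟩
    scale (κ * c + -1ℤ * e) P                                   ∎
  where
  open ≃-Reasoning
  c e : ℤ
  c = weight κ u * weight κ v
  e = ε u * ε v
  P : LinComb
  P = shuffle⁺ u v

Ψ-weight-prefix⁰ : ∀ κ L → Ψ (weight κ) (prefix (+ 0) L) ≃ []
Ψ-weight-prefix⁰ κ L = Ψ-prefix-null (weight κ) (+ 0) L (λ _ → refl)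

Ψ-weight-prefix-star-null : ∀ {κ} → κ * κ ≡ κ → ∀ x u v → WeightStarToShuffle u v →
  (∀ μ → weight μ u * weight μ v ≡ 0ℤ) → ε u * ε v ≡ 0ℤ → Ψ (weight κ) (prefix x (star u v)) ≃ []
Ψ-weight-prefix-star-null {κ} idem +[1+ n ] u v hom weight≡0 ε≡0 =
  ≃-trans (Ψ-weight-prefix⁺ κ n u v (hom refl)) (scale-null (prefix +[1+ n ] (shuffle⁺ u v)) (weight≡0 0ℤ))
Ψ-weight-prefix-star-null {κ} idem -[1+ n ] u v hom weight≡0 ε≡0 =
  ≃-trans (Ψ-weight-prefix⁻ κ n u v (hom idem)) (scale-null (shuffle⁺ u v) coefficient)
  where
  coefficient : κ * (weight κ u * weight κ v) + -1ℤ * (ε u * ε v) ≡ 0ℤ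
  coefficient rewrite weight≡0 κ | ε≡0 = cong (_+ 0ℤ) (ℤP.*-zeroʳ κ)
Ψ-weight-prefix-star-null {κ} idem (+ 0) u v hom weight≡0 ε≡0 = Ψ-weight-prefix⁰ κ (star u v)

prefix-shuffle⁺-ε : ∀ n c u v →
  scale (c * ε v) (prefix +[1+ n ] (shuffle⁺ u v)) ≃ scale (c * ε v) (shuffle⁺ (+[1+ n ] ∷ u) v)
prefix-shuffle⁺-ε n c u [] =
  ≡⇒≃ (cong (λ L → scale (c * 1ℤ) (prefix +[1+ n ] L)) (shuffle-identityʳ (positives u)))
prefix-shuffle⁺-ε n c u v@(_ ∷ _) =
  ≃-trans (scale-null (prefix +[1+ n ] (shuffle⁺ u v)) (ℤP.*-zeroʳ c))
          (≃-sym (scale-null (shuffle⁺ (+[1+ n ] ∷ u) v) (ℤP.*-zeroʳ c)))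

prefix-shuffle⁺-εʳ : ∀ n c u v →
  scale (ε u * c) (prefix +[1+ n ] (shuffle⁺ u v)) ≃ scale (ε u * c) (shuffle⁺ u (+[1+ n ] ∷ v))
prefix-shuffle⁺-εʳ n c [] v = ≃-refl
prefix-shuffle⁺-εʳ n c u@(_ ∷ _) v =
  ≃-trans (scale-zero (prefix +[1+ n ] (shuffle⁺ u v))) (≃-sym (scale-zero (shuffle⁺ u (+[1+ n ] ∷ v))))

star-shuffle-zeroˡ : ∀ {κ} → κ * κ ≡ κ → ∀ b u v → WeightStarToShuffle (+ 0 ∷ u) v →
  StarToShuffle (weight κ) (+ 0 ∷ u) (b ∷ v)
star-shuffle-zeroˡ {κ} idem b u v homY = begin
    Ψ h (star (+ 0 ∷ u) (b ∷ v))                   ≡⟨ Ψ-star-∷ h (+ 0) b u v ⟩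
    Ψ h (prefix (+ 0) X) ++ Ψ h (prefix b Y) ++ []  ≈⟨ ++-cong (Ψ-weight-prefix⁰ κ X) (++-cong Y-null ≃-refl) ⟩
    []                                             ≈⟨ scale-zero (shuffle⁺ (+ 0 ∷ u) (b ∷ v)) ⟨
    scale 0ℤ (shuffle⁺ (+ 0 ∷ u) (b ∷ v))          ∎
  where
  open ≃-Reasoning
  h : Word → ℤ
  h = weight κ
  X Y : LinComb
  X = star u (b ∷ v)
  Y = star (+ 0 ∷ u) v
  Y-null : Ψ h (prefix b Y) ≃ []
  Y-null = Ψ-weight-prefix-star-null idem b (+ 0 ∷ u) v homY (λ _ → refl) refl

star-shuffle-zeroʳ : ∀ {κ} → κ * κ ≡ κ → ∀ a u v → WeightStarToShuffle u (+ 0 ∷ v) →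
  StarToShuffle (weight κ) (a ∷ u) (+ 0 ∷ v)
star-shuffle-zeroʳ {κ} idem a u v homX = begin
    Ψ h (star (a ∷ u) (+ 0 ∷ v))                                   ≡⟨ Ψ-star-∷ h a (+ 0) u v ⟩
    Ψ h (prefix a X) ++ Ψ h (prefix (+ 0) Y) ++ Ψ h (merge a (+ 0) u v)
      ≡⟨ cong (λ M → Ψ h (prefix a X) ++ Ψ h (prefix (+ 0) Y) ++ Ψ h M) (merge-nonneg a (+ 0) u v refl) ⟩
    Ψ h (prefix a X) ++ Ψ h (prefix (+ 0) Y) ++ []                 ≈⟨ ++-cong X-null (++-cong (Ψ-weight-prefix⁰ κ Y) ≃-refl) ⟩
    []                                                             ≈⟨ scale-null P (ℤP.*-zeroʳ (h (a ∷ u))) ⟨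
    scale (h (a ∷ u) * 0ℤ) P                                       ∎
  where
  open ≃-Reasoning
  h : Word → ℤ
  h = weight κ
  X Y P : LinComb
  X = star u (+ 0 ∷ v)
  Y = star (a ∷ u) v
  P = shuffle⁺ (a ∷ u) (+ 0 ∷ v)
  X-null : Ψ h (prefix a X) ≃ []
  X-null = Ψ-weight-prefix-star-null idem a u (+ 0 ∷ v) homX (λ μ → ℤP.*-zeroʳ (weight μ u)) (ℤP.*-zeroʳ (ε u))

star-shuffle-pos-pos : ∀ κ m n u v →
  StarToShuffle (weight 0ℤ) u (+[1+ n ] ∷ v) → StarToShuffle (weight 0ℤ) (+[1+ m ] ∷ u) v →
  StarToShuffle (weight κ) (+[1+ m ] ∷ u) (+[1+ n ] ∷ v)
star-shuffle-pos-pos κ m n u v homX homY = begin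
    Ψ h (star (a ∷ u) (b ∷ v))                            ≡⟨ Ψ-star-∷ h a b u v ⟩
    Ψ h (prefix a X) ++ Ψ h (prefix b Y) ++ []            ≈⟨ ++-cong (Ψ-weight-prefix⁺ κ m u (b ∷ v) homX)
                                                               (++-cong (Ψ-weight-prefix⁺ κ n (a ∷ u) v homY) ≃-refl) ⟩
    scale c (prefix a P) ++ scale c (prefix b Q) ++ []    ≡⟨ cong (scale c (prefix a P) ++_) (ListP.++-identityʳ _) ⟩
    scale c (prefix a P) ++ scale c (prefix b Q)          ≡⟨ scale-++ c (prefix a P) (prefix b Q) ⟨
    scale c (shuffle⁺ (a ∷ u) (b ∷ v))                    ∎
  where
  open ≃-Reasoning
  h : Word → ℤ
  h = weight κ
  a b c : ℤ
  a = +[1+ m ]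
  b = +[1+ n ]
  c = weight 0ℤ u * weight 0ℤ v
  X Y P Q : LinComb
  X = star u (b ∷ v)
  Y = star (a ∷ u) v
  P = shuffle⁺ u (b ∷ v)
  Q = shuffle⁺ (a ∷ u) v

star-shuffle-pos-neg : ∀ κ m n u v →
  StarToShuffle (weight 0ℤ) u (-[1+ n ] ∷ v) → StarToShuffle (weight κ) (+[1+ m ] ∷ u) v →
  StarToShuffle (weight κ) (+[1+ m ] ∷ u) (-[1+ n ] ∷ v)
star-shuffle-pos-neg κ m n u v homX homY = begin
    Ψ h (star (a ∷ u) (b ∷ v))                                ≡⟨ Ψ-star-∷ h a b u v ⟩
    Ψ h (prefix a X) ++ Ψ h (prefix b Y) ++ []
      ≈⟨ scale-collect₃ (- r * e) (κ * (r * x) + -1ℤ * (0ℤ * e)) 0ℤ P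
           X-term (Ψ-weight-prefix⁻ κ n (a ∷ u) v homY) (≃-sym (scale-zero P)) ⟩
    scale (- r * e + (κ * (r * x) + -1ℤ * (0ℤ * e) + 0ℤ)) P   ≡⟨ cong (λ k → scale k P) (collect κ r x e) ⟩
    scale (r * (κ * x - e)) P                                 ∎
  where
  open ≃-Reasoning
  h : Word → ℤ
  h = weight κ
  a b r x e : ℤ
  a = +[1+ m ]
  b = -[1+ n ]
  r = weight 0ℤ u
  x = weight κ v
  e = ε v
  X Y P : LinComb
  X = star u (b ∷ v)
  Y = star (a ∷ u) v
  P = shuffle⁺ (a ∷ u) v
  collect : ∀ κ r x e → - r * e + (κ * (r * x) + -1ℤ * (0ℤ * e) + 0ℤ) ≡ r * (κ * x - e)
  collect = solve-∀
  X-term : Ψ h (prefix a X) ≃ scale (- r * e) P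
  X-term = begin
      Ψ h (prefix a X)                                   ≈⟨ Ψ-weight-prefix⁺ κ m u (b ∷ v) homX ⟩
      scale (r * (0ℤ - e)) (prefix a (shuffle⁺ u v))     ≡⟨ cong (λ k → scale k (prefix a (shuffle⁺ u v))) (negate r e) ⟩
      scale (- r * e) (prefix a (shuffle⁺ u v))          ≈⟨ prefix-shuffle⁺-ε m (- r) u v ⟩
      scale (- r * e) P                                  ∎
    where
    negate : ∀ r e → r * (0ℤ - e) ≡ - r * e
    negate = solve-∀

star-shuffle-neg-pos : ∀ κ m n u v →
  StarToShuffle (weight κ) u (+[1+ n ] ∷ v) → StarToShuffle (weight 0ℤ) (-[1+ m ] ∷ u) v →
  StarToShuffle (weight κ) (-[1+ m ] ∷ u) (+[1+ n ] ∷ v)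
star-shuffle-neg-pos κ m n u v homX homY = begin
    Ψ h (star (a ∷ u) (b ∷ v))                                ≡⟨ Ψ-star-∷ h a b u v ⟩
    Ψ h (prefix a X) ++ Ψ h (prefix b Y) ++ []
      ≈⟨ scale-collect₃ (κ * (x * r) + -1ℤ * (e * 0ℤ)) (e * - r) 0ℤ P
           (Ψ-weight-prefix⁻ κ m u (b ∷ v) homX) Y-term (≃-sym (scale-zero P)) ⟩
    scale (κ * (x * r) + -1ℤ * (e * 0ℤ) + (e * - r + 0ℤ)) P   ≡⟨ cong (λ k → scale k P) (collect κ r x e) ⟩
    scale ((κ * x - e) * r) P                                 ∎
  where
  open ≃-Reasoning
  h : Word → ℤ
  h = weight κ
  a b r x e : ℤ
  a = -[1+ m ]
  b = +[1+ n ]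
  r = weight 0ℤ v
  x = weight κ u
  e = ε u
  X Y P : LinComb
  X = star u (b ∷ v)
  Y = star (a ∷ u) v
  P = shuffle⁺ u (b ∷ v)
  collect : ∀ κ r x e → κ * (x * r) + -1ℤ * (e * 0ℤ) + (e * - r + 0ℤ) ≡ (κ * x - e) * r
  collect = solve-∀
  Y-term : Ψ h (prefix b Y) ≃ scale (e * - r) P
  Y-term = begin
      Ψ h (prefix b Y)                                   ≈⟨ Ψ-weight-prefix⁺ κ n (a ∷ u) v homY ⟩
      scale ((0ℤ - e) * r) (prefix b (shuffle⁺ u v))     ≡⟨ cong (λ k → scale k (prefix b (shuffle⁺ u v))) (negate e r) ⟩
      scale (e * - r) (prefix b (shuffle⁺ u v))          ≈⟨ prefix-shuffle⁺-εʳ n (- r) u v ⟩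
      scale (e * - r) P                                  ∎
    where
    negate : ∀ e r → (0ℤ - e) * r ≡ e * - r
    negate = solve-∀

-- The two sides differ by (κ * κ - κ) * x * y: this is where the coefficient -1 of
-- the merge term forces κ to be idempotent.
neg-neg-identity : ∀ κ → κ * κ ≡ κ → ∀ x y p q →
  κ * (x * (κ * y - q)) + -1ℤ * (p * 0ℤ) + (κ * ((κ * x - p) * y) + -1ℤ * (0ℤ * q)
    + -1ℤ * (κ * (x * y) + -1ℤ * (p * q))) ≡ (κ * x - p) * (κ * y - q)
neg-neg-identity κ idem x y p q = begin
    κ * (x * (κ * y - q)) + -1ℤ * (p * 0ℤ) + (κ * ((κ * x - p) * y) + -1ℤ * (0ℤ * q)
      + -1ℤ * (κ * (x * y) + -1ℤ * (p * q)))                   ≡⟨ expand κ x y p q ⟩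
    (κ * x - p) * (κ * y - q) + (κ * κ - κ) * (x * y)          ≡⟨ cong (λ k → (κ * x - p) * (κ * y - q) + (k - κ) * (x * y)) idem ⟩
    (κ * x - p) * (κ * y - q) + (κ - κ) * (x * y)              ≡⟨ cancel κ ((κ * x - p) * (κ * y - q)) (x * y) ⟩
    (κ * x - p) * (κ * y - q)                                  ∎
  where
  open ≡-Reasoning
  expand : ∀ κ x y p q →
    κ * (x * (κ * y - q)) + -1ℤ * (p * 0ℤ) + (κ * ((κ * x - p) * y) + -1ℤ * (0ℤ * q)
      + -1ℤ * (κ * (x * y) + -1ℤ * (p * q))) ≡ (κ * x - p) * (κ * y - q) + (κ * κ - κ) * (x * y)
  expand = solve-∀
  cancel : ∀ κ r s → r + (κ - κ) * s ≡ r
  cancel = solve-∀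

star-shuffle-neg-neg : ∀ κ → κ * κ ≡ κ → ∀ m n u v →
  StarToShuffle (weight κ) u (-[1+ n ] ∷ v) → StarToShuffle (weight κ) (-[1+ m ] ∷ u) v →
  StarToShuffle (weight κ) u v → StarToShuffle (weight κ) (-[1+ m ] ∷ u) (-[1+ n ] ∷ v)
star-shuffle-neg-neg κ idem m n u v homX homY homZ = begin
    Ψ h (star (a ∷ u) (b ∷ v))                                                ≡⟨ Ψ-star-∷ h a b u v ⟩
    Ψ h (prefix a X) ++ Ψ h (prefix b Y) ++ Ψ h (scale -1ℤ (prefix a Z))
      ≈⟨ scale-collect₃ (κ * (x * (κ * y - q)) + -1ℤ * (p * 0ℤ)) (κ * ((κ * x - p) * y) + -1ℤ * (0ℤ * q)) (-1ℤ * c) P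
           (Ψ-weight-prefix⁻ κ m u (b ∷ v) homX) (Ψ-weight-prefix⁻ κ n (a ∷ u) v homY) Z-term ⟩
    scale (κ * (x * (κ * y - q)) + -1ℤ * (p * 0ℤ) + (κ * ((κ * x - p) * y) + -1ℤ * (0ℤ * q) + -1ℤ * c)) P
      ≡⟨ cong (λ k → scale k P) (neg-neg-identity κ idem x y p q) ⟩
    scale ((κ * x - p) * (κ * y - q)) P                                       ∎
  where
  open ≃-Reasoning
  h : Word → ℤ
  h = weight κ
  a b x y p q c : ℤ
  a = -[1+ m ]
  b = -[1+ n ]
  x = weight κ u
  y = weight κ v
  p = ε u
  q = ε v
  c = κ * (x * y) + -1ℤ * (p * q)
  X Y Z P : LinComb
  X = star u (b ∷ v)
  Y = star (a ∷ u) v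
  Z = star u v
  P = shuffle⁺ u v
  Z-term : Ψ h (scale -1ℤ (prefix a Z)) ≃ scale (-1ℤ * c) P
  Z-term = begin
      Ψ h (scale -1ℤ (prefix a Z))    ≈⟨ Ψ-scale h -1ℤ (prefix a Z) ⟩
      scale -1ℤ (Ψ h (prefix a Z))    ≈⟨ scale-cong -1ℤ (Ψ-weight-prefix⁻ κ m u v homZ) ⟩
      scale -1ℤ (scale c P)           ≡⟨ scale-scale -1ℤ c P ⟩
      scale (-1ℤ * c) P               ∎

star-shuffle-∷ : ∀ {κ} → κ * κ ≡ κ → ∀ a b u v →
  WeightStarToShuffle u (b ∷ v) → WeightStarToShuffle (a ∷ u) v → WeightStarToShuffle u v →
  StarToShuffle (weight κ) (a ∷ u) (b ∷ v)
star-shuffle-∷ idem (+ 0) b u v homX homY homZ = star-shuffle-zeroˡ idem b u v homY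
star-shuffle-∷ idem a (+ 0) u v homX homY homZ = star-shuffle-zeroʳ idem a u v homX
star-shuffle-∷ {κ} idem +[1+ m ] +[1+ n ] u v homX homY homZ =
  star-shuffle-pos-pos κ m n u v (homX refl) (homY refl)
star-shuffle-∷ {κ} idem +[1+ m ] -[1+ n ] u v homX homY homZ =
  star-shuffle-pos-neg κ m n u v (homX refl) (homY idem)
star-shuffle-∷ {κ} idem -[1+ m ] +[1+ n ] u v homX homY homZ =
  star-shuffle-neg-pos κ m n u v (homX idem) (homY refl)
star-shuffle-∷ {κ} idem -[1+ m ] -[1+ n ] u v homX homY homZ =
  star-shuffle-neg-neg κ idem m n u v (homX idem) (homY idem) (homZ idem)

weight-star-shuffle : ∀ u v → WeightStarToShuffle u v
weight-star-shuffle [] v {μ} _ = star-shuffle-[]ˡ (weight μ) refl v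
weight-star-shuffle (a ∷ u) [] {μ} _ = star-shuffle-[]ʳ (weight μ) refl a u
weight-star-shuffle (a ∷ u) (b ∷ v) idem = star-shuffle-∷ idem a b u v
  (weight-star-shuffle u (b ∷ v)) (weight-star-shuffle (a ∷ u) v) (weight-star-shuffle u v)

-- φ₂ through weights

-- The condition imposed by `pattern?` on the letter at position k (from 0), with ⌊_⌋
-- replaced by `does`, which computes on open terms.
shape : Word → ℕ → ℕ → ℕ → Bool
shape π i j k =
  if does (suc k ℕ.≤? i) ∨ does ((length π ∸ j) ℕ.<? suc k) then isNeg (lookupD π k) else isPos (lookupD π k)

Pattern : Word → ℕ → ℕ → Bool
Pattern π i j = does ((i ℕ.+ j) ℕ.<? length π) ∧ all? (shape π i j) (length π)

-- Tail w j: w is a block of positive letters followed by j negative letters.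
Tail : Word → ℕ → Bool
Tail w j = all? (shape w 0 j) (length w)

patternSign : ℕ → ℤ
patternSign j = if ⌊ j ℕ.≟ 0 ⌋ then 1ℤ else -1ℤ

does-true⇒ : ∀ {P : Set} (d : Dec P) → does d ≡ true → P
does-true⇒ (yes p) _ = p

all?-cong : ∀ {p q} n → (∀ k → p k ≡ q k) → all? p n ≡ all? q n
all?-cong zero p≗q = refl
all?-cong (suc n) p≗q = cong₂ _∧_ (p≗q n) (all?-cong n p≗q)

all?-suc : ∀ p n → all? p (suc n) ≡ p 0 ∧ all? (p ∘ suc) n
all?-suc p zero = refl
all?-suc p (suc n) = trans (cong (p (suc n) ∧_) (all?-suc p n)) (∧-rotate (p (suc n)) (p 0) _)
  where
  ∧-rotate : ∀ a b c → a ∧ (b ∧ c) ≡ b ∧ (a ∧ c)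
  ∧-rotate a b c = trans (sym (BoolP.∧-assoc a b c)) (trans (cong (_∧ c) (BoolP.∧-comm a b)) (BoolP.∧-assoc b a c))

pattern?≡Pattern : ∀ π i j → pattern? π i j ≡ Pattern π i j
pattern?≡Pattern π i j = cong₂ _∧_ (isYes≗does ((i ℕ.+ j) ℕ.<? length π)) (all?-cong (length π) λ k →
  cong (λ b → if b then isNeg (lookupD π k) else isPos (lookupD π k))
       (cong₂ _∨_ (isYes≗does (suc k ℕ.≤? i)) (isYes≗does ((length π ∸ j) ℕ.<? suc k))))

∸-<-suc : ∀ n j k → does ((suc n ∸ j) ℕ.<? suc (suc k)) ≡ does ((n ∸ j) ℕ.<? suc k)
∸-<-suc n zero k = refl
∸-<-suc zero (suc zero) k = refl
∸-<-suc zero (suc (suc j)) k = refl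
∸-<-suc (suc n) (suc j) k = ∸-<-suc n j k

shape-∷ : ∀ x w i j k → shape (x ∷ w) i j (suc k) ≡ shape w (ℕ.pred i) j k
shape-∷ x w zero j k rewrite ∸-<-suc (length w) j k = refl
shape-∷ x w (suc i) j k rewrite ∸-<-suc (length w) j k = refl

Pattern-suc : ∀ x w i j → Pattern (x ∷ w) (suc i) j ≡ isNeg x ∧ Pattern w i j
Pattern-suc x w i j = begin
    d ∧ all? (shape (x ∷ w) (suc i) j) (suc (length w))
      ≡⟨ cong (d ∧_) (all?-suc (shape (x ∷ w) (suc i) j) (length w)) ⟩
    d ∧ (isNeg x ∧ all? (shape (x ∷ w) (suc i) j ∘ suc) (length w))
      ≡⟨ cong (λ b → d ∧ (isNeg x ∧ b)) (all?-cong (length w) (shape-∷ x w (suc i) j)) ⟩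
    d ∧ (isNeg x ∧ t)          ≡⟨ BoolP.∧-assoc d (isNeg x) t ⟨
    (d ∧ isNeg x) ∧ t          ≡⟨ cong (_∧ t) (BoolP.∧-comm d (isNeg x)) ⟩
    (isNeg x ∧ d) ∧ t          ≡⟨ BoolP.∧-assoc (isNeg x) d t ⟩
    isNeg x ∧ Pattern w i j    ∎
  where
  open ≡-Reasoning
  d t : Bool
  d = does ((i ℕ.+ j) ℕ.<? length w)
  t = all? (shape w i j) (length w)

Tail-∷ : ∀ x w j → j ℕ.≤ length w → Tail (x ∷ w) j ≡ isPos x ∧ Tail w j
Tail-∷ x w j j≤n = begin
    all? (shape (x ∷ w) 0 j) (suc (length w))
      ≡⟨ all?-suc (shape (x ∷ w) 0 j) (length w) ⟩
    shape (x ∷ w) 0 j 0 ∧ all? (shape (x ∷ w) 0 j ∘ suc) (length w)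
      ≡⟨ cong₂ _∧_ first-positive (all?-cong (length w) (shape-∷ x w 0 j)) ⟩
    isPos x ∧ Tail w j
      ∎
  where
  open ≡-Reasoning
  first-positive : shape (x ∷ w) 0 j 0 ≡ isPos x
  first-positive rewrite NatP.+-∸-assoc 1 j≤n = refl

Tail-weight : ∀ w j → j ℕ.≤ 1 → j ℕ.≤ length w → Tail w j ≡ true → weight 0ℤ w ≡ patternSign j
Tail-weight [] zero _ _ _ = refl
Tail-weight (x ∷ w) j j≤1 j≤n tail with j ℕ.≤? length w
... | yes j≤m = first-positive x (trans (sym (Tail-∷ x w j j≤m)) tail)
  where
  first-positive : ∀ x → isPos x ∧ Tail w j ≡ true → weight 0ℤ (x ∷ w) ≡ patternSign j
  first-positive +[1+ n ] tail′ = Tail-weight w j j≤1 j≤m tail′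
... | no j≰m = last-negative x w j j≤1 j≤n j≰m tail
  where
  last-negative : ∀ x w j → j ℕ.≤ 1 → j ℕ.≤ suc (length w) → ¬ j ℕ.≤ length w → Tail (x ∷ w) j ≡ true →
    weight 0ℤ (x ∷ w) ≡ patternSign j
  last-negative x w zero _ _ j≰m _ = ⊥-elim (j≰m ℕ.z≤n)
  last-negative -[1+ n ] [] (suc zero) _ _ _ _ = refl
  last-negative (+ n) [] (suc zero) _ _ _ ()
  last-negative x (_ ∷ _) (suc zero) _ _ j≰m _ = ⊥-elim (j≰m (ℕ.s≤s ℕ.z≤n))
  last-negative x w (suc (suc j)) (ℕ.s≤s ()) _ _ _

Pattern-weight : ∀ w i j → j ℕ.≤ 1 → Pattern w i j ≡ true → weight 1ℤ w ≡ patternSign j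
Pattern-weight (x ∷ w) (suc i) j j≤1 pat = first-negative x w (trans (sym (Pattern-suc x w i j)) pat)
  where
  first-negative : ∀ x w → isNeg x ∧ Pattern w i j ≡ true → weight 1ℤ (x ∷ w) ≡ patternSign j
  first-negative -[1+ n ] w@(_ ∷ _) pat′ =
    trans (ℤP.+-identityʳ _) (trans (ℤP.*-identityˡ _) (Pattern-weight w i j j≤1 pat′))
Pattern-weight (x ∷ w) zero j j≤1 pat = first-positive x (trans (sym (Tail-∷ x w j j≤m)) tail)
  where
  j<n? : Dec (j ℕ.< suc (length w))
  j<n? = j ℕ.<? suc (length w)
  j≤m : j ℕ.≤ length w
  j≤m = ℕ.s≤s⁻¹ (does-true⇒ j<n? (BoolP.∧-conicalˡ (does j<n?) (Tail (x ∷ w) j) pat))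
  tail : Tail (x ∷ w) j ≡ true
  tail = BoolP.∧-conicalʳ (does j<n?) (Tail (x ∷ w) j) pat
  first-positive : ∀ x → isPos x ∧ Tail w j ≡ true → weight 1ℤ (x ∷ w) ≡ patternSign j
  first-positive +[1+ n ] tail′ = Tail-weight w j j≤1 j≤m tail′

weight-Tail : ∀ w → weight 0ℤ w ≢ 0ℤ → ∃[ j ] j ℕ.≤ 1 × j ℕ.≤ length w × Tail w j ≡ true
weight-Tail [] _ = 0 , ℕ.z≤n , ℕ.z≤n , refl
weight-Tail (+[1+ n ] ∷ w) w≢0 with weight-Tail w w≢0
... | j , j≤1 , j≤m , tail = j , j≤1 , NatP.m≤n⇒m≤1+n j≤m , trans (Tail-∷ +[1+ n ] w j j≤m) tail
weight-Tail (-[1+ n ] ∷ []) _ = 1 , ℕ.s≤s ℕ.z≤n , ℕ.s≤s ℕ.z≤n , refl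
weight-Tail (-[1+ n ] ∷ _ ∷ _) w≢0 = ⊥-elim (w≢0 refl)
weight-Tail (+ 0 ∷ w) w≢0 = ⊥-elim (w≢0 refl)

weight-Pattern : ∀ w → w ≢ [] → weight 1ℤ w ≢ 0ℤ →
  ∃[ i ] ∃[ j ] i ℕ.< length w × j ℕ.≤ 1 × Pattern w i j ≡ true
weight-Pattern [] w≢[] _ = ⊥-elim (w≢[] refl)
weight-Pattern (+[1+ n ] ∷ w) _ w≢0 with weight-Tail w w≢0
... | j , j≤1 , j≤m , tail = 0 , j , ℕ.s≤s ℕ.z≤n , j≤1 ,
  cong₂ _∧_ (dec-true (j ℕ.<? suc (length w)) (ℕ.s≤s j≤m)) (trans (Tail-∷ +[1+ n ] w j j≤m) tail)
weight-Pattern (-[1+ n ] ∷ []) _ w≢0 = ⊥-elim (w≢0 refl)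
weight-Pattern (-[1+ n ] ∷ w@(_ ∷ _)) _ w≢0
  with weight-Pattern w (λ ()) (λ w≡0 → w≢0 (trans (ℤP.+-identityʳ _) (trans (ℤP.*-identityˡ _) w≡0)))
... | i , j , i<m , j≤1 , pat = suc i , j , ℕ.s≤s i<m , j≤1 , trans (Pattern-suc -[1+ n ] w i j) pat
weight-Pattern (+ 0 ∷ w) _ w≢0 = ⊥-elim (w≢0 refl)

candidates : ℕ → List (ℕ × ℕ)
candidates n = concatMap (λ i → (i , 0) ∷ (i , 1) ∷ []) (upTo n)

matches? : ∀ π (p : ℕ × ℕ) → Dec (pattern? π (proj₁ p) (proj₂ p) ≡ true)
matches? π p = pattern? π (proj₁ p) (proj₂ p) BoolP.≟ true

candidate-≤1 : ∀ n {p} → p ∈ candidates n → proj₂ p ℕ.≤ 1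
candidate-≤1 n p∈ with satisfied (∈-concatMap⁻ (λ i → (i , 0) ∷ (i , 1) ∷ []) {xs = upTo n} p∈)
... | _ , here refl = ℕ.z≤n
... | _ , there (here refl) = ℕ.s≤s ℕ.z≤n

candidate-∈ : ∀ {n i j} → i ℕ.< n → j ℕ.≤ 1 → (i , j) ∈ candidates n
candidate-∈ {i = i} {j} i<n j≤1 =
  ∈-concatMap⁺ (λ i → (i , 0) ∷ (i , 1) ∷ []) (Any.map (λ { refl → pair-∈ j j≤1 }) (∈-upTo⁺ i<n))
  where
  pair-∈ : ∀ j → j ℕ.≤ 1 → (i , j) ∈ (i , 0) ∷ (i , 1) ∷ []
  pair-∈ zero _ = here refl
  pair-∈ (suc zero) _ = there (here refl)
  pair-∈ (suc (suc _)) (ℕ.s≤s ())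

φ₂-weight : ∀ w → φ₂ w ≃ (weight 1ℤ w , st (positives w)) ∷ []
φ₂-weight [] = ≃-refl
φ₂-weight w@(x ∷ u) with findPattern w in found
... | (i , j) ∷ _ = ≡⇒≃ (cong (λ k → (k , st (positives w)) ∷ []) (sym (Pattern-weight w i j j≤1 pat)))
  where
  ij∈ : (i , j) ∈ candidates (length w) × pattern? w i j ≡ true
  ij∈ = ∈-filter⁻ (matches? w) (subst ((i , j) ∈_) (sym found) (here refl))
  j≤1 : j ℕ.≤ 1
  j≤1 = candidate-≤1 (length w) (proj₁ ij∈)
  pat : Pattern w i j ≡ true
  pat = trans (sym (pattern?≡Pattern w i j)) (proj₂ ij∈)
... | [] = ≃-sym (singleton-null (st (positives w)) weight≡0)
  where
  weight≡0 : weight 1ℤ w ≡ 0ℤ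
  weight≡0 with weight 1ℤ w ℤ.≟ 0ℤ
  ... | yes w≡0 = w≡0
  ... | no w≢0 with weight-Pattern w (λ ()) w≢0
  ...   | i , j , i<n , j≤1 , pat with () ← subst ((i , j) ∈_) found
          (∈-filter⁺ (matches? w) (candidate-∈ i<n j≤1) (trans (pattern?≡Pattern w i j) pat))

-- Standardization

smaller? : ℤ → ℤ → Bool
smaller? y x = ⌊ ∣ y ∣ ℕ.<? ∣ x ∣ ⌋

countBelow : Word → ℤ → ℕ
countBelow z x = count (λ y → smaller? y x) z

withSignOf : ℤ → ℕ → ℤ
withSignOf x r = if isNeg x then - (+ r) else + r

rank : Word → ℤ → ℤ
rank z x = withSignOf x (suc (countBelow z x))

-- Copies of the local definitions of `st`: `st a` unfolds to `map (st-entry a) (indexed a)`.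
indexed : Word → List (ℕ × ℤ)
indexed a = zip (upTo (length a)) a

precedes : ℕ × ℤ → ℕ × ℤ → Bool
precedes (j , aj) (i , ai) = ⌊ ∣ aj ∣ ℕ.<? ∣ ai ∣ ⌋ ∨ (⌊ ∣ aj ∣ ℕ.≟ ∣ ai ∣ ⌋ ∧ ⌊ j ℕ.<? i ⌋)

st-entry : Word → ℕ × ℤ → ℤ
st-entry a (i , ai) = withSignOf ai (suc (count (λ q → precedes q (i , ai)) (indexed a)))

⌊⌋-false : ∀ {P : Set} (d : Dec P) → ¬ P → ⌊ d ⌋ ≡ false
⌊⌋-false d ¬p = trans (isYes≗does d) (dec-false d ¬p)

⌊⌋-true : ∀ {P : Set} (d : Dec P) → P → ⌊ d ⌋ ≡ true
⌊⌋-true d p = trans (isYes≗does d) (dec-true d p)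

smaller?-irrefl : ∀ x → smaller? x x ≡ false
smaller?-irrefl x = ⌊⌋-false (∣ x ∣ ℕ.<? ∣ x ∣) (NatP.<-irrefl refl)

smaller?-true : ∀ y x → smaller? y x ≡ true → ∣ y ∣ ℕ.< ∣ x ∣
smaller?-true y x = does-true⇒ (∣ y ∣ ℕ.<? ∣ x ∣) ∘ trans (sym (isYes≗does (∣ y ∣ ℕ.<? ∣ x ∣)))

count-cong : ∀ {A : Set} {p q : A → Bool} {xs} → All (λ x → p x ≡ q x) xs → count p xs ≡ count q xs
count-cong [] = refl
count-cong (px≡qx ∷ rest) = cong₂ (λ b n → (if b then 1 else 0) ℕ.+ n) px≡qx (count-cong rest)

count-map : ∀ {A B : Set} (p : B → Bool) (f : A → B) xs → count p (map f xs) ≡ count (p ∘ f) xs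
count-map p f [] = refl
count-map p f (x ∷ xs) = cong ((if p (f x) then 1 else 0) ℕ.+_) (count-map p f xs)

count-++ : ∀ {A : Set} (p : A → Bool) xs ys → count p (xs ++ ys) ≡ count p xs ℕ.+ count p ys
count-++ p [] ys = refl
count-++ p (x ∷ xs) ys = trans (cong ((if p x then 1 else 0) ℕ.+_) (count-++ p xs ys))
  (sym (NatP.+-assoc (if p x then 1 else 0) (count p xs) (count p ys)))

count-none : ∀ {A : Set} (p : A → Bool) {xs} → All (λ x → p x ≡ false) xs → count p xs ≡ 0
count-none p [] = refl
count-none p (px ∷ rest) rewrite px = count-none p rest

count-all : ∀ {A : Set} (p : A → Bool) {xs} → All (λ x → p x ≡ true) xs → count p xs ≡ length xs
count-all p [] = refl
count-all p (px ∷ rest) rewrite px = cong suc (count-all p rest)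

count-↭ : ∀ {A : Set} (p : A → Bool) {xs ys} → xs ↭ ys → count p xs ≡ count p ys
count-↭ p ↭.refl = refl
count-↭ p (↭.prep x xs↭ys) = cong ((if p x then 1 else 0) ℕ.+_) (count-↭ p xs↭ys)
count-↭ p (↭.swap x y xs↭ys) rewrite count-↭ p xs↭ys =
  +-exchange (if p x then 1 else 0) (if p y then 1 else 0) _
  where
  +-exchange : ∀ a b n → a ℕ.+ (b ℕ.+ n) ≡ b ℕ.+ (a ℕ.+ n)
  +-exchange a b n = trans (sym (NatP.+-assoc a b n)) (trans (cong (ℕ._+ n) (NatP.+-comm a b)) (NatP.+-assoc b a n))
count-↭ p (↭.trans xs↭ys ys↭zs) = trans (count-↭ p xs↭ys) (count-↭ p ys↭zs)

count-mono : ∀ {A : Set} {p q : A → Bool} xs → (∀ x → p x ≡ true → q x ≡ true) → count p xs ℕ.≤ count q xs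
count-mono [] p⇒q = ℕ.z≤n
count-mono {p = p} {q} (x ∷ xs) p⇒q with p x in px | q x in qx
... | true | true = ℕ.s≤s (count-mono xs p⇒q)
... | true | false with () ← trans (sym (p⇒q x px)) qx
... | false | true = NatP.m≤n⇒m≤1+n (count-mono xs p⇒q)
... | false | false = count-mono xs p⇒q

count-mono-strict : ∀ {A : Set} {p q : A → Bool} {y} xs → y ∈ xs → p y ≡ false → q y ≡ true →
  (∀ x → p x ≡ true → q x ≡ true) → count p xs ℕ.< count q xs
count-mono-strict (x ∷ xs) (here refl) py qy p⇒q rewrite py | qy = ℕ.s≤s (count-mono xs p⇒q)
count-mono-strict {p = p} {q} (x ∷ xs) (there y∈) py qy p⇒q with p x in px | q x in qx
... | true | true = ℕ.s≤s (count-mono-strict xs y∈ py qy p⇒q)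
... | true | false with () ← trans (sym (p⇒q x px)) qx
... | false | true = NatP.m≤n⇒m≤1+n (count-mono-strict xs y∈ py qy p⇒q)
... | false | false = count-mono-strict xs y∈ py qy p⇒q

countBelow-mono : ∀ z {x x′} → ∣ x ∣ ℕ.≤ ∣ x′ ∣ → countBelow z x ℕ.≤ countBelow z x′
countBelow-mono z {x} {x′} x≤x′ = count-mono z λ y y<x →
  ⌊⌋-true (∣ y ∣ ℕ.<? ∣ x′ ∣) (NatP.<-≤-trans (smaller?-true y x y<x) x≤x′)

countBelow-strict : ∀ z {x x′} → x ∈ z → ∣ x ∣ ℕ.< ∣ x′ ∣ → countBelow z x ℕ.< countBelow z x′
countBelow-strict z {x} {x′} x∈z x<x′ =
  count-mono-strict z x∈z (smaller?-irrefl x) (⌊⌋-true (∣ x ∣ ℕ.<? ∣ x′ ∣) x<x′) λ y y<x →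
    ⌊⌋-true (∣ y ∣ ℕ.<? ∣ x′ ∣) (NatP.<-trans (smaller?-true y x y<x) x<x′)

precedes-self : ∀ i a → precedes (i , a) (i , a) ≡ false
precedes-self i a rewrite smaller?-irrefl a | ⌊⌋-false (i ℕ.<? i) (NatP.<-irrefl refl) = BoolP.∧-zeroʳ _

precedes-apart : ∀ q p → ∣ proj₂ q ∣ ≢ ∣ proj₂ p ∣ → precedes q p ≡ smaller? (proj₂ q) (proj₂ p)
precedes-apart (j , b) (i , a) b≢a rewrite ⌊⌋-false (∣ b ∣ ℕ.≟ ∣ a ∣) b≢a = BoolP.∨-identityʳ _

-- With pairwise distinct absolute values, the tie-break by position never fires.
count-precedes : ∀ Z → Unique (map (∣_∣ ∘ proj₂) Z) → ∀ {i a} → (i , a) ∈ Z →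
  count (λ q → precedes q (i , a)) Z ≡ countBelow (map proj₂ Z) a
count-precedes ((j , b) ∷ Z) (b-apart ∷ _) (here refl) =
  cong₂ (λ c n → (if c then 1 else 0) ℕ.+ n) (trans (precedes-self j b) (sym (smaller?-irrefl b)))
    (trans (count-cong (All.map (λ {q} → precedes-apart q (j , b)) (AllP.map⁻ (All.map (_∘ sym) b-apart))))
           (sym (count-map (λ y → smaller? y b) proj₂ Z)))
count-precedes ((j , b) ∷ Z) (b-apart ∷ uniq) {i} {a} (there ia∈) =
  cong₂ (λ c n → (if c then 1 else 0) ℕ.+ n)
    (precedes-apart (j , b) (i , a) (All.lookup (AllP.map⁻ b-apart) ia∈))
    (count-precedes Z uniq ia∈)

map-proj₂-zip : ∀ (xs : List ℕ) (w : Word) → length w ℕ.≤ length xs → map proj₂ (zip xs w) ≡ w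
map-proj₂-zip [] [] _ = refl
map-proj₂-zip (_ ∷ _) [] _ = refl
map-proj₂-zip (x ∷ xs) (y ∷ w) (ℕ.s≤s |w|≤) = cong (y ∷_) (map-proj₂-zip xs w |w|≤)

map-proj₂-indexed : ∀ w → map proj₂ (indexed w) ≡ w
map-proj₂-indexed w = map-proj₂-zip (upTo (length w)) w (NatP.≤-reflexive (sym (ListP.length-upTo (length w))))

length-st : ∀ w → length (st w) ≡ length w
length-st w = trans (ListP.length-map (st-entry w) (indexed w))
  (trans (sym (ListP.length-map proj₂ (indexed w))) (cong length (map-proj₂-indexed w)))

st-rank : ∀ w → Unique (map ∣_∣ w) → st w ≡ map (rank w) w
st-rank w uniq = begin
    st w                                    ≡⟨⟩
    map (st-entry w) (indexed w)            ≡⟨ ListP.map-cong-local (All.tabulate entry≡rank) ⟩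
    map (rank w ∘ proj₂) (indexed w)        ≡⟨ ListP.map-∘ (indexed w) ⟩
    map (rank w) (map proj₂ (indexed w))    ≡⟨ cong (map (rank w)) (map-proj₂-indexed w) ⟩
    map (rank w) w                          ∎
  where
  open ≡-Reasoning
  uniq′ : Unique (map (∣_∣ ∘ proj₂) (indexed w))
  uniq′ = subst Unique (sym (trans (ListP.map-∘ (indexed w)) (cong (map ∣_∣) (map-proj₂-indexed w)))) uniq
  entry≡rank : ∀ {q} → q ∈ indexed w → st-entry w q ≡ rank w (proj₂ q)
  entry≡rank {i , a} q∈ = cong (λ n → withSignOf a (suc n))
    (trans (count-precedes (indexed w) uniq′ q∈) (cong (λ z → countBelow z a) (map-proj₂-indexed w)))

∣rank∣ : ∀ z x → ∣ rank z x ∣ ≡ suc (countBelow z x)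
∣rank∣ z x with isNeg x
... | true = refl
... | false = refl

isNeg-rank : ∀ z x → isNeg (rank z x) ≡ isNeg x
isNeg-rank z (+ n) = refl
isNeg-rank z -[1+ n ] = refl

SameSign : ℤ → ℤ → Set
SameSign y x = isPos y ≡ isPos x × isNeg y ≡ isNeg x

rank-sign : ∀ z x → x ≢ 0ℤ → SameSign (rank z x) x
rank-sign z +[1+ n ] _ = refl , refl
rank-sign z -[1+ n ] _ = refl , refl
rank-sign z (+ 0) x≢0 = ⊥-elim (x≢0 refl)

rank-smaller? : ∀ z {u v} → u ∈ z → smaller? (rank z u) (rank z v) ≡ smaller? u v
rank-smaller? z {u} {v} u∈z rewrite ∣rank∣ z u | ∣rank∣ z v with ∣ u ∣ ℕ.<? ∣ v ∣
... | yes u<v = ⌊⌋-true (suc (countBelow z u) ℕ.<? suc (countBelow z v)) (ℕ.s≤s (countBelow-strict z {u} {v} u∈z u<v))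
... | no u≮v = ⌊⌋-false (suc (countBelow z u) ℕ.<? suc (countBelow z v))
  (NatP.≤⇒≯ (ℕ.s≤s (countBelow-mono z {v} {u} (NatP.≮⇒≥ u≮v))))

∣rank∣-injective : ∀ z {u v} → u ∈ z → v ∈ z → ∣ rank z u ∣ ≡ ∣ rank z v ∣ → ∣ u ∣ ≡ ∣ v ∣
∣rank∣-injective z {u} {v} u∈z v∈z eq with NatP.<-cmp ∣ u ∣ ∣ v ∣
... | tri< u<v _ _ = ⊥-elim (NatP.<-irrefl (NatP.suc-injective (trans (sym (∣rank∣ z u)) (trans eq (∣rank∣ z v))))
                                          (countBelow-strict z {u} {v} u∈z u<v))
... | tri≈ _ u≡v _ = u≡v
... | tri> _ _ v<u = ⊥-elim (NatP.<-irrefl (NatP.suc-injective (trans (sym (∣rank∣ z v)) (trans (sym eq) (∣rank∣ z u))))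
                                          (countBelow-strict z {v} {u} v∈z v<u))

rank-↭ : ∀ {z z′} → z ↭ z′ → ∀ x → rank z x ≡ rank z′ x
rank-↭ z↭z′ x = cong (λ n → withSignOf x (suc n)) (count-↭ (λ y → smaller? y x) z↭z′)

Unique-↭ : ∀ {xs ys : List ℕ} → xs ↭ ys → Unique xs → Unique ys
Unique-↭ xs↭ys = PermSetoidP.Unique-resp-↭ (↭.↭⇒↭ₛ xs↭ys)

Unique-++ˡ : ∀ {A : Set} (xs : List A) {ys} → Unique (xs ++ ys) → Unique xs
Unique-++ˡ [] _ = []
Unique-++ˡ (x ∷ xs) (x-apart ∷ uniq) = AllP.++⁻ˡ xs x-apart ∷ Unique-++ˡ xs uniq

Unique-++ʳ : ∀ {A : Set} (xs : List A) {ys} → Unique (xs ++ ys) → Unique ys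
Unique-++ʳ [] uniq = uniq
Unique-++ʳ (x ∷ xs) (_ ∷ uniq) = Unique-++ʳ xs uniq

Unique-positives : ∀ w → Unique (map ∣_∣ w) → Unique (map ∣_∣ (positives w))
Unique-positives w uniq = AllPairsP.map⁺ (AllPairsP.filter⁺ (λ x → 0ℤ ℤ.<? x) (AllPairsP.map⁻ uniq))

Unique-map-rank : ∀ z p → p ⊆ z → Unique (map ∣_∣ p) → Unique (map ∣_∣ (map (rank z) p))
Unique-map-rank z [] p⊆z [] = []
Unique-map-rank z (x ∷ p) p⊆z (x-apart ∷ uniq) =
  AllP.map⁺ (AllP.map⁺ (All.tabulate λ {y} y∈p →
    All.lookup (AllP.map⁻ x-apart) y∈p ∘ ∣rank∣-injective z (p⊆z (here refl)) (p⊆z (there y∈p))))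
  ∷ Unique-map-rank z p (p⊆z ∘ there) uniq

st-map-rank : ∀ z p → p ⊆ z → Unique (map ∣_∣ p) → st (map (rank z) p) ≡ st p
st-map-rank z p p⊆z uniq = begin
    st (map (rank z) p)                              ≡⟨ st-rank (map (rank z) p) (Unique-map-rank z p p⊆z uniq) ⟩
    map (rank (map (rank z) p)) (map (rank z) p)     ≡⟨ ListP.map-∘ p ⟨
    map (rank (map (rank z) p) ∘ rank z) p           ≡⟨ ListP.map-cong-local (All.tabulate rerank) ⟩
    map (rank p) p                                   ≡⟨ st-rank p uniq ⟨
    st p                                             ∎
  where
  open ≡-Reasoning
  rerank : ∀ {v} → v ∈ p → rank (map (rank z) p) (rank z v) ≡ rank p v
  rerank {v} v∈p rewrite isNeg-rank z v = cong (λ n → withSignOf v (suc n)) (begin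
      count (λ y → smaller? y (rank z v)) (map (rank z) p)    ≡⟨ count-map (λ y → smaller? y (rank z v)) (rank z) p ⟩
      count (λ y → smaller? (rank z y) (rank z v)) p
        ≡⟨ count-cong (All.tabulate λ {y} y∈p → rank-smaller? z {y} {v} (p⊆z y∈p)) ⟩
      countBelow p v                                          ∎)

positives-∷ : ∀ x w → positives (x ∷ w) ≡ (if isPos x then x ∷ positives w else positives w)
positives-∷ x w with 0ℤ ℤ.<? x
... | yes _ = refl
... | no _ = refl

positives-map : ∀ (f : ℤ → ℤ) w → All (λ x → isPos (f x) ≡ isPos x) w → positives (map f w) ≡ map f (positives w)
positives-map f [] [] = refl
positives-map f (x ∷ w) (fx≡x ∷ rest) rewrite positives-∷ (f x) (map f w) | positives-∷ x w | fx≡x with isPos x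
... | true = cong (f x ∷_) (positives-map f w rest)
... | false = positives-map f w rest

ε-map : ∀ (f : ℤ → ℤ) w → ε (map f w) ≡ ε w
ε-map f [] = refl
ε-map f (_ ∷ _) = refl

weight-map : ∀ (f : ℤ → ℤ) κ w → All (λ x → SameSign (f x) x) w → weight κ (map f w) ≡ weight κ w
weight-map f κ [] [] = refl
weight-map f κ (x ∷ w) ((pos≡ , neg≡) ∷ rest)
  rewrite pos≡ | neg≡ | weight-map f 0ℤ w rest | weight-map f κ w rest | ε-map f w = refl

φ₂-st : ∀ w → Unique (map ∣_∣ w) → All (_≢ 0ℤ) w → φ₂ (st w) ≃ (weight 1ℤ w , st (positives w)) ∷ []
φ₂-st w uniq nonzero = ≃-trans (φ₂-weight (st w)) (≡⇒≃ (cong₂ (λ k v → (k , v) ∷ []) weight≡ st≡))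
  where
  open ≡-Reasoning
  signs : All (λ x → SameSign (rank w x) x) w
  signs = All.map (λ {x} → rank-sign w x) nonzero
  weight≡ : weight 1ℤ (st w) ≡ weight 1ℤ w
  weight≡ = trans (cong (weight 1ℤ) (st-rank w uniq)) (weight-map (rank w) 1ℤ w signs)
  st≡ : st (positives (st w)) ≡ st (positives w)
  st≡ = begin
      st (positives (st w))              ≡⟨ cong (st ∘ positives) (st-rank w uniq) ⟩
      st (positives (map (rank w) w))    ≡⟨ cong st (positives-map (rank w) w (All.map proj₁ signs)) ⟩
      st (map (rank w) (positives w))    ≡⟨ st-map-rank w (positives w) (SubsetP.filter-⊆ (λ x → 0ℤ ℤ.<? x) w)
                                                        (Unique-positives w uniq) ⟩
      st (positives w)                   ∎

shuffle-↭ : ∀ u v → All (λ q → proj₂ q ↭ u ++ v) (shuffle u v)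
shuffle-↭ [] v = ↭.↭-refl ∷ []
shuffle-↭ (a ∷ u) [] = ↭.↭-reflexive (sym (ListP.++-identityʳ (a ∷ u))) ∷ []
shuffle-↭ (a ∷ u) (b ∷ v) = AllP.++⁺
  (AllP.map⁺ (All.map (↭.prep a) (shuffle-↭ u (b ∷ v))))
  (AllP.map⁺ (All.map (λ q↭ → ↭.↭-trans (↭.prep b q↭) (↭.↭-sym (PermP.shift b (a ∷ u) v))) (shuffle-↭ (a ∷ u) v)))

shuffle-map : ∀ (f : ℤ → ℤ) u v → map (Product.map₂ (map f)) (shuffle u v) ≡ shuffle (map f u) (map f v)
shuffle-map f [] v = refl
shuffle-map f (a ∷ u) [] = refl
shuffle-map f (a ∷ u) (b ∷ v) = begin
    map F (prefix a (shuffle u (b ∷ v)) ++ prefix b (shuffle (a ∷ u) v))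
      ≡⟨ ListP.map-++ F (prefix a (shuffle u (b ∷ v))) (prefix b (shuffle (a ∷ u) v)) ⟩
    map F (prefix a (shuffle u (b ∷ v))) ++ map F (prefix b (shuffle (a ∷ u) v))
      ≡⟨ cong₂ _++_ (trans (map-prefix a (shuffle u (b ∷ v))) (cong (prefix (f a)) (shuffle-map f u (b ∷ v))))
                    (trans (map-prefix b (shuffle (a ∷ u) v)) (cong (prefix (f b)) (shuffle-map f (a ∷ u) v))) ⟩
    prefix (f a) (shuffle (map f u) (map f (b ∷ v))) ++ prefix (f b) (shuffle (map f (a ∷ u)) (map f v))
      ∎
  where
  open ≡-Reasoning
  F : ℤ × Word → ℤ × Word
  F = Product.map₂ (map f)
  map-prefix : ∀ c L → map F (prefix c L) ≡ prefix (f c) (map F L)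
  map-prefix c L = trans (sym (ListP.map-∘ L)) (ListP.map-∘ L)

∣shiftLetter∣ : ∀ m z → ∣ shiftLetter m z ∣ ≡ ∣ z ∣ ℕ.+ m
∣shiftLetter∣ m (+ n) = refl
∣shiftLetter∣ m -[1+ n ] = refl

map-∣shift∣ : ∀ m w → map ∣_∣ (shift m w) ≡ map (ℕ._+ m) (map ∣_∣ w)
map-∣shift∣ m w = trans (sym (ListP.map-∘ w)) (trans (ListP.map-cong (∣shiftLetter∣ m) w) (ListP.map-∘ w))

smaller?-shift : ∀ m u z → smaller? (shiftLetter m u) (shiftLetter m z) ≡ smaller? u z
smaller?-shift m u z rewrite ∣shiftLetter∣ m u | ∣shiftLetter∣ m z with ∣ u ∣ ℕ.<? ∣ z ∣
... | yes u<z = ⌊⌋-true (∣ u ∣ ℕ.+ m ℕ.<? ∣ z ∣ ℕ.+ m) (NatP.+-monoˡ-< m u<z)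
... | no u≮z = ⌊⌋-false (∣ u ∣ ℕ.+ m ℕ.<? ∣ z ∣ ℕ.+ m) (u≮z ∘ NatP.+-cancelʳ-< m ∣ u ∣ ∣ z ∣)

st-↭-rank : ∀ {x z} → x ↭ z → Unique (map ∣_∣ z) → st x ≡ map (rank z) x
st-↭-rank {x} x↭z uniq =
  trans (st-rank x (Unique-↭ (PermP.map⁺ ∣_∣ (↭.↭-sym x↭z)) uniq)) (ListP.map-cong (rank-↭ x↭z) x)

-- Every letter of `shift m b` lies above every letter of `a`, so the rank of a letter
-- of `a` in `a ++ shift m b` is its rank in `a`, and the rank of a shifted letter is
-- its rank in `b` shifted by `length a`.
st-shuffle : ∀ m a b → All (λ y → ∣ y ∣ ℕ.≤ m) a → All (λ z → isPos z ≡ true) b →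
  Unique (map ∣_∣ (a ++ shift m b)) → stL (shuffle a (shift m b)) ≡ shuffle (st a) (shift (length a) (st b))
st-shuffle m a b a≤m b>0 uniq = begin
    stL (shuffle a (shift m b))
      ≡⟨ ListP.map-cong-local (All.map (λ {q} q↭ → cong (proj₁ q ,_) (st-↭-rank q↭ uniq)) (shuffle-↭ a (shift m b))) ⟩
    map (Product.map₂ (map H)) (shuffle a (shift m b))    ≡⟨ shuffle-map H a (shift m b) ⟩
    shuffle (map H a) (map H (shift m b))                 ≡⟨ cong₂ shuffle H-on-a H-on-b ⟩
    shuffle (st a) (shift (length a) (st b))              ∎
  where
  open ≡-Reasoning
  H : ℤ → ℤ
  H = rank (a ++ shift m b)
  uniq-ab : Unique (map ∣_∣ a ++ map (ℕ._+ m) (map ∣_∣ b))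
  uniq-ab = subst Unique (trans (ListP.map-++ ∣_∣ a (shift m b)) (cong (map ∣_∣ a ++_) (map-∣shift∣ m b))) uniq
  H-on-a : map H a ≡ st a
  H-on-a = trans (ListP.map-cong-local (All.map (λ {y} y≤m → cong (λ n → withSignOf y (suc n)) (below {y} y≤m)) a≤m))
                 (sym (st-rank a (Unique-++ˡ (map ∣_∣ a) uniq-ab)))
    where
    below : ∀ {y} → ∣ y ∣ ℕ.≤ m → countBelow (a ++ shift m b) y ≡ countBelow a y
    below {y} y≤m = trans (count-++ (λ x → smaller? x y) a (shift m b))
      (trans (cong (countBelow a y ℕ.+_) (count-none (λ x → smaller? x y) (AllP.map⁺ (All.map above b>0))))
             (NatP.+-identityʳ _))
      where
      above : ∀ {z} → isPos z ≡ true → smaller? (shiftLetter m z) y ≡ false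
      above {+[1+ n ]} _ = ⌊⌋-false (suc n ℕ.+ m ℕ.<? ∣ y ∣) (NatP.≤⇒≯ (NatP.≤-trans y≤m (NatP.m≤n+m m (suc n))))
  H-on-b : map H (shift m b) ≡ shift (length a) (st b)
  H-on-b = begin
      map H (shift m b)                          ≡⟨ ListP.map-∘ b ⟨
      map (H ∘ shiftLetter m) b                  ≡⟨ ListP.map-cong-local (All.map shifted-rank b>0) ⟩
      map (shiftLetter (length a) ∘ rank b) b    ≡⟨ ListP.map-∘ b ⟩
      shift (length a) (map (rank b) b)          ≡⟨ cong (shift (length a)) (st-rank b uniq-b) ⟨
      shift (length a) (st b)                    ∎
    where
    uniq-b : Unique (map ∣_∣ b)
    uniq-b = UniqueP.map⁻ (Unique-++ʳ (map ∣_∣ a) uniq-ab)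
    shifted-rank : ∀ {z} → isPos z ≡ true → H (shiftLetter m z) ≡ shiftLetter (length a) (rank b z)
    shifted-rank {+[1+ n ]} _ = cong +_ (begin
        suc (countBelow (a ++ shift m b) z′)                  ≡⟨ cong suc (count-++ (λ x → smaller? x z′) a (shift m b)) ⟩
        suc (countBelow a z′ ℕ.+ countBelow (shift m b) z′)   ≡⟨ cong₂ (λ k l → suc (k ℕ.+ l)) all-below shifted-below ⟩
        suc (length a ℕ.+ countBelow b +[1+ n ])              ≡⟨ cong suc (NatP.+-comm (length a) (countBelow b +[1+ n ])) ⟩
        suc (countBelow b +[1+ n ] ℕ.+ length a)              ∎)
      where
      z′ : ℤ
      z′ = shiftLetter m +[1+ n ]
      all-below : countBelow a z′ ≡ length a
      all-below = count-all (λ x → smaller? x z′) (All.map (λ {y} y≤m →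
        ⌊⌋-true (∣ y ∣ ℕ.<? suc n ℕ.+ m) (ℕ.s≤s (NatP.≤-trans y≤m (NatP.m≤n+m m n))))  a≤m)
      shifted-below : countBelow (shift m b) z′ ≡ countBelow b +[1+ n ]
      shifted-below = trans (count-map (λ x → smaller? x z′) (shiftLetter m) b)
                            (count-cong {xs = b} (All.tabulate λ {x} _ → smaller?-shift m x +[1+ n ]))

-- Signed permutations

SubMultiset : Word → Word → Set
SubMultiset w z = ∃[ r ] w ++ r ↭ z

SubMultiset-Unique : ∀ {w z} → SubMultiset w z → Unique (map ∣_∣ z) → Unique (map ∣_∣ w)
SubMultiset-Unique {w} (r , w++r↭z) uniq = Unique-++ˡ (map ∣_∣ w)
  (subst Unique (ListP.map-++ ∣_∣ w r) (Unique-↭ (PermP.map⁺ ∣_∣ (↭.↭-sym w++r↭z)) uniq))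

SubMultiset-All : ∀ {P : ℤ → Set} {w z} → SubMultiset w z → All P z → All P w
SubMultiset-All {w = w} (r , w++r↭z) all = AllP.++⁻ˡ w (PermP.All-resp-↭ (↭.↭-sym w++r↭z) all)

star-support : ∀ u v → All (λ q → SubMultiset (proj₂ q) (u ++ v)) (star u v)
star-support [] v = ([] , ↭.↭-reflexive (ListP.++-identityʳ v)) ∷ []
star-support (a ∷ u) [] = ([] , ↭.↭-refl) ∷ []
star-support (a ∷ u) (b ∷ v) =
  AllP.++⁺ (prefix-support a (star-support u (b ∷ v)) λ { (r , p) → r , ↭.prep a p })
  (AllP.++⁺ (prefix-support b (star-support (a ∷ u) v) λ { (r , p) → r , ↭.↭-trans (↭.prep b p) b-moved })
            (merge-support (isNeg a ∧ isNeg b)))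
  where
  b-moved : b ∷ (a ∷ u) ++ v ↭ (a ∷ u) ++ b ∷ v
  b-moved = ↭.↭-sym (PermP.shift b (a ∷ u) v)
  prefix-support : ∀ {P Q : Word → Set} c {L} → All (P ∘ proj₂) L → (∀ {w} → P w → Q (c ∷ w)) →
    All (Q ∘ proj₂) (prefix c L)
  prefix-support c all P⇒Q = AllP.map⁺ (All.map P⇒Q all)
  merge-support : ∀ t →
    All (λ q → SubMultiset (proj₂ q) ((a ∷ u) ++ b ∷ v)) (if t then scale -1ℤ (prefix a (star u v)) else [])
  merge-support true = AllP.map⁺ (prefix-support a (star-support u v) λ { {w} (r , p) →
    b ∷ r , ↭.↭-trans (↭.prep a (PermP.shift b w r)) (↭.prep a (↭.↭-trans (↭.prep b p) (↭.↭-sym (PermP.shift b u v)))) })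
  merge-support false = []

shiftLetter-sign : ∀ m x → x ≢ 0ℤ → SameSign (shiftLetter m x) x
shiftLetter-sign m +[1+ n ] _ = refl , refl
shiftLetter-sign m -[1+ n ] _ = refl , refl
shiftLetter-sign m (+ 0) x≢0 = ⊥-elim (x≢0 refl)

shiftLetter-nonzero : ∀ m x → x ≢ 0ℤ → shiftLetter m x ≢ 0ℤ
shiftLetter-nonzero m +[1+ n ] _ ()
shiftLetter-nonzero m -[1+ n ] _ ()
shiftLetter-nonzero m (+ 0) x≢0 = ⊥-elim (x≢0 refl)

nonzero⇒1≤∣∣ : ∀ {x} → x ≢ 0ℤ → 1 ℕ.≤ ∣ x ∣
nonzero⇒1≤∣∣ {+[1+ n ]} _ = ℕ.s≤s ℕ.z≤n
nonzero⇒1≤∣∣ { -[1+ n ]} _ = ℕ.s≤s ℕ.z≤n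
nonzero⇒1≤∣∣ {+ 0} x≢0 = ⊥-elim (x≢0 refl)

Unique-++-shift : ∀ m a b → Unique (map ∣_∣ a) → Unique (map ∣_∣ b) →
  All (λ y → ∣ y ∣ ℕ.≤ m) a → All (_≢ 0ℤ) b → Unique (map ∣_∣ (a ++ shift m b))
Unique-++-shift m a b uniq-a uniq-b a≤m b≢0 =
  subst Unique (sym (trans (ListP.map-++ ∣_∣ a (shift m b)) (cong (map ∣_∣ a ++_) (map-∣shift∣ m b))))
    (UniqueP.++⁺ uniq-a (UniqueP.map⁺ (NatP.+-cancelʳ-≡ _ _ _) uniq-b) disjoint)
  where
  disjoint : ∀ {k} → ¬ (k ∈ map ∣_∣ a × k ∈ map (ℕ._+ m) (map ∣_∣ b))
  disjoint (k∈a , k∈b) with ∈-map⁻ ∣_∣ k∈a | ∈-map⁻ (ℕ._+ m) k∈b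
  ... | y , y∈a , refl | l , l∈b , eq with ∈-map⁻ ∣_∣ l∈b
  ...   | z , z∈b , refl =
    NatP.<-irrefl eq (NatP.≤-<-trans (All.lookup a≤m y∈a) (NatP.m<n+m m (nonzero⇒1≤∣∣ (All.lookup b≢0 z∈b))))

module SignedPerm {m σ} (perm : IsSignedPerm m σ) where

  letter : ∀ {y} → y ∈ σ → ∃[ k ] k ℕ.< m × ∣ y ∣ ≡ suc k
  letter y∈σ with ∈-map⁻ suc (PermP.∈-resp-↭ perm (∈-map⁺ ∣_∣ y∈σ))
  ... | k , k∈ , eq = k , ∈-upTo⁻ k∈ , eq

  length≡ : length σ ≡ m
  length≡ = trans (sym (ListP.length-map ∣_∣ σ))
    (trans (PermP.↭-length perm) (trans (ListP.length-map suc (upTo m)) (ListP.length-upTo m)))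

  unique : Unique (map ∣_∣ σ)
  unique = Unique-↭ (↭.↭-sym perm) (UniqueP.map⁺ NatP.suc-injective (UniqueP.upTo⁺ m))

  nonzero : All (_≢ 0ℤ) σ
  nonzero = All.tabulate λ y∈σ y≡0 → case letter y∈σ of λ
    { (_ , _ , eq) → NatP.0≢1+n (trans (cong ∣_∣ (sym y≡0)) eq) }

  bounded : All (λ y → ∣ y ∣ ℕ.≤ length σ) σ
  bounded = All.tabulate λ {y} y∈σ → case letter y∈σ of λ
    { (_ , k<m , eq) → subst (∣ y ∣ ℕ.≤_) (sym length≡) (subst (ℕ._≤ m) (sym eq) k<m) }

stL-as-linExt : ∀ L → stL L ≡ linExt (λ w → (1ℤ , st w) ∷ []) L
stL-as-linExt [] = refl
stL-as-linExt ((c , w) ∷ L) = cong₂ (λ k M → (k , st w) ∷ M) (sym (ℤP.*-identityʳ c)) (stL-as-linExt L)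

stL-cong : ∀ {L M} → L ≃ M → stL L ≃ stL M
stL-cong {L} {M} L≃M = begin
    stL L                                  ≡⟨ stL-as-linExt L ⟩
    linExt (λ w → (1ℤ , st w) ∷ []) L      ≈⟨ linExt-cong (λ w → (1ℤ , st w) ∷ []) L≃M ⟩
    linExt (λ w → (1ℤ , st w) ∷ []) M      ≡⟨ stL-as-linExt M ⟨
    stL M                                  ∎
  where open ≃-Reasoning

stL-scale : ∀ c L → stL (scale c L) ≡ scale c (stL L)
stL-scale c L = trans (sym (ListP.map-∘ L)) (ListP.map-∘ L)

stL-Ψ : ∀ h L → linExt (λ w → (h w , st (positives w)) ∷ []) L ≡ stL (Ψ h L)
stL-Ψ h [] = refl
stL-Ψ h ((c , w) ∷ L) = cong (_ ∷_) (stL-Ψ h L)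

φ₂L-stL : ∀ L → All (λ q → Unique (map ∣_∣ (proj₂ q)) × All (_≢ 0ℤ) (proj₂ q)) L →
  φ₂L (stL L) ≃ stL (Ψ (weight 1ℤ) L)
φ₂L-stL L distinct = begin
    linExt φ₂ (stL L)                                         ≡⟨ cong concat (ListP.map-∘ L) ⟨
    linExt (φ₂ ∘ st) L                                        ≈⟨ linExt-cong-local L (All.map (λ { (uniq , nz) → φ₂-st _ uniq nz }) distinct) ⟩
    linExt (λ w → (weight 1ℤ w , st (positives w)) ∷ []) L    ≡⟨ stL-Ψ (weight 1ℤ) L ⟩
    stL (Ψ (weight 1ℤ) L)                                     ∎
  where open ≃-Reasoning

module _ {m n σ τ} (σ-perm : IsSignedPerm m σ) (τ-perm : IsSignedPerm n τ) where

  private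
    module Sσ = SignedPerm σ-perm
    module Sτ = SignedPerm τ-perm
    ℓ : ℕ
    ℓ = length σ
    shift-signs : All (λ x → SameSign (shiftLetter ℓ x) x) τ
    shift-signs = All.map (λ {x} → shiftLetter-sign ℓ x) Sτ.nonzero

  weight-shift : ∀ κ → weight κ (shift ℓ τ) ≡ weight κ τ
  weight-shift κ = weight-map (shiftLetter ℓ) κ τ shift-signs

  star-letters-distinct : All (λ q → Unique (map ∣_∣ (proj₂ q)) × All (_≢ 0ℤ) (proj₂ q)) (star σ (shift ℓ τ))
  star-letters-distinct =
    All.map (λ sub → SubMultiset-Unique sub unique , SubMultiset-All sub nonzero) (star-support σ (shift ℓ τ))
    where
    unique : Unique (map ∣_∣ (σ ++ shift ℓ τ))
    unique = Unique-++-shift ℓ σ τ Sσ.unique Sτ.unique Sσ.bounded Sτ.nonzero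
    nonzero : All (_≢ 0ℤ) (σ ++ shift ℓ τ)
    nonzero = AllP.++⁺ Sσ.nonzero (AllP.map⁺ (All.map (λ {x} → shiftLetter-nonzero ℓ x) Sτ.nonzero))

  stL-shuffle⁺ : stL (shuffle⁺ σ (shift ℓ τ)) ≡ sprod (st (positives σ)) (st (positives τ))
  stL-shuffle⁺ = begin
      stL (shuffle σ⁺ (positives (shift ℓ τ)))        ≡⟨ cong (stL ∘ shuffle σ⁺) (positives-map (shiftLetter ℓ) τ (All.map proj₁ shift-signs)) ⟩
      stL (shuffle σ⁺ (shift ℓ τ⁺))                   ≡⟨ st-shuffle ℓ σ⁺ τ⁺ (positives-All Sσ.bounded) τ⁺-positive unique ⟩
      shuffle (st σ⁺) (shift (length σ⁺) (st τ⁺))     ≡⟨ cong (λ k → shuffle (st σ⁺) (shift k (st τ⁺))) (length-st σ⁺) ⟨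
      sprod (st σ⁺) (st τ⁺)                           ∎
    where
    open ≡-Reasoning
    σ⁺ τ⁺ : Word
    σ⁺ = positives σ
    τ⁺ = positives τ
    positives-All : ∀ {P : ℤ → Set} {w} → All P w → All P (positives w)
    positives-All = AllP.filter⁺ (λ x → 0ℤ ℤ.<? x)
    τ⁺-positive : All (λ z → isPos z ≡ true) τ⁺
    τ⁺-positive = All.map (⌊⌋-true (0ℤ ℤ.<? _)) (AllP.all-filter (λ x → 0ℤ ℤ.<? x) τ)
    unique : Unique (map ∣_∣ (σ⁺ ++ shift ℓ τ⁺))
    unique = Unique-++-shift ℓ σ⁺ τ⁺ (Unique-positives σ Sσ.unique) (Unique-positives τ Sτ.unique)
               (positives-All Sσ.bounded) (positives-All Sτ.nonzero)

  φ₂-hprod : φ₂L (hprod σ τ) ≃ bilinExt sprod (φ₂ σ) (φ₂ τ)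
  φ₂-hprod = begin
      φ₂L (stL (star σ τ′))                                   ≈⟨ φ₂L-stL (star σ τ′) star-letters-distinct ⟩
      stL (Ψ w (star σ τ′))                                   ≈⟨ stL-cong (weight-star-shuffle σ τ′ refl) ⟩
      stL (scale (w σ * w τ′) (shuffle⁺ σ τ′))                ≡⟨ stL-scale (w σ * w τ′) (shuffle⁺ σ τ′) ⟩
      scale (w σ * w τ′) (stL (shuffle⁺ σ τ′))                ≡⟨ cong₂ scale (cong (w σ *_) (weight-shift 1ℤ)) stL-shuffle⁺ ⟩
      scale (w σ * w τ) (sprod (st σ⁺) (st τ⁺))              ≡⟨ bilinExt-singletons sprod (w σ) (st σ⁺) (w τ) (st τ⁺) ⟨
      bilinExt sprod ((w σ , st σ⁺) ∷ []) ((w τ , st τ⁺) ∷ [])  ≈⟨ bilinExt-cong sprod (φ₂-weight σ) (φ₂-weight τ) ⟨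
      bilinExt sprod (φ₂ σ) (φ₂ τ)                            ∎
    where
    open ≃-Reasoning
    w : Word → ℤ
    w = weight 1ℤ
    τ′ σ⁺ τ⁺ : Word
    τ′ = shift ℓ τ
    σ⁺ = positives σ
    τ⁺ = positives τ

proposition4p9 : (φ₂ [] ≈ (1ℤ , []) ∷ [])
    × (∀ (m n : ℕ) (σ τ : Word) → IsSignedPerm m σ → IsSignedPerm n τ →
         φ₂L (hprod σ τ) ≈ bilinExt sprod (φ₂ σ) (φ₂ τ))
proposition4p9 = (λ _ → refl) , λ m n σ τ σ-perm τ-perm → coeff-≡ (φ₂-hprod σ-perm τ-perm)
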